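{- Let $k,m$ be positive integers with $k<m$ and $m$ odd, and let $k'$ be the unique solution modulo $m$ of $2x\equiv k \pmod m$. Let $G$ be a $2$-connected graph in which every cycle has length congruent to $k$ modulo $m$. Let $H$ be obtained from $G$ by attaching a new ear $E$ (a path whose two endpoints $u\ne v$ lie in $G$ and whose internal vertices are new), and suppose every cycle of $H$ also has length congruent to $k$ modulo $m$. Then (1) every path in $H$ connecting $u$ and $v$ has length congruent to $k'$ modulo $m$; and (2) for every ear decomposition $G=P_0\cup P_1\cup\cdots\cup P_t$ of $G$ (with $P_0$ a cycle and $P_1,\dots,P_t$ the ears in order of attachment), $u$ and $v$ lie on the same ear, i.e. $u,v\in V(P_i)$ for some $i\in\{0,\dots,t\}$.
   Context: Graphs are finite and simple. A graph is $2$-connected if it has at least $3$ vertices and no vertex whose removal disconnects it. The length of a path or cycle is its number of edges. An ear decomposition of a $2$-connected graph writes it as an initial cycle $P_0$ followed by paths $P_1,\dots,P_t$ where each $P_i$ has its two distinct endpoints in $P_0\cup\cdots\cup P_{i-1}$ and its internal vertices outside it. -}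

module Defs where

open import Data.Nat using (ℕ; zero; suc; _+_; _*_; _∸_; _≤_; _≡ᵇ_)
open import Data.Bool using (Bool; true; false; _∧_; _∨_)
open import Data.Bool.Properties using (∨-comm; ∧-zeroʳ)
open import Data.Fin using (Fin; toℕ; splitAt; _↑ˡ_; _↑ʳ_; _≟_)
open import Data.Sum using (_⊎_; inj₁; inj₂)
open import Data.Product using (Σ; ∃; ∃₂; _×_; _,_)
open import Data.List using (List; []; _∷_; _++_; [_]; length; head; last)
open import Data.Maybe using (Maybe; just)
open import Data.List.Relation.Unary.Linked using (Linked)
open import Data.List.Relation.Unary.Unique.Propositional using (Unique)
open import Data.List.Membership.Propositional using (_∈_; _∉_)
open import Relation.Nullary using (¬_; yes; no)
open import Relation.Nullary.Decidable using (⌊_⌋)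
open import Relation.Binary.PropositionalEquality using (_≡_; _≢_; refl)

infix 4 _≡ₘ_[mod_]
_≡ₘ_[mod_] : ℕ → ℕ → ℕ → Set
a ≡ₘ b [mod m ] = ∃₂ λ p q → a + p * m ≡ b + q * m

record Graph (n : ℕ) : Set where
  field
    adj    : Fin n → Fin n → Bool
    sym    : ∀ a b → adj a b ≡ adj b a
    irrefl : ∀ a → adj a a ≡ false

open Graph public

Adj : ∀ {n} → Graph n → Fin n → Fin n → Set
Adj G a b = adj G a b ≡ true

record Path {n} (G : Graph n) (a b : Fin n) : Set where
  field
    verts  : List (Fin n)
    linked : Linked (Adj G) verts
    unique : Unique verts
    start  : head verts ≡ just a
    end    : last verts ≡ just b

open Path public

pathLength : ∀ {n} {G : Graph n} {a b} → Path G a b → ℕ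
pathLength p = length (verts p) ∸ 1

IsCycle : ∀ {n} → Graph n → List (Fin n) → Set
IsCycle G xs =
  3 ≤ length xs × Linked (Adj G) xs × Unique xs ×
  (∃₂ λ a b → head xs ≡ just a × last xs ≡ just b × Adj G b a)

AllCyclesMod : ∀ {n} → Graph n → ℕ → ℕ → Set
AllCyclesMod G k m = ∀ xs → IsCycle G xs → length xs ≡ₘ k [mod m ]

Connected : ∀ {n} → Graph n → Set
Connected G = ∀ a b → Path G a b

TwoConnected : ∀ {n} → Graph n → Set
TwoConnected {n} G =
  3 ≤ n × Connected G ×
  (∀ x a b → a ≢ x → b ≢ x → Σ (Path G a b) λ p → x ∉ verts p)

data Consec {A : Set} : List A → A → A → Set where
  here  : ∀ {a b xs} → Consec (a ∷ b ∷ xs) a b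
  there : ∀ {x xs a b} → Consec xs a b → Consec (x ∷ xs) a b

EdgeOfPath : ∀ {n} → List (Fin n) → Fin n → Fin n → Set
EdgeOfPath xs a b = Consec xs a b ⊎ Consec xs b a

EdgeOfCycle : ∀ {n} → List (Fin n) → Fin n → Fin n → Set
EdgeOfCycle xs a b =
  EdgeOfPath xs a b ⊎
  ((head xs ≡ just a × last xs ≡ just b) ⊎ (head xs ≡ just b × last xs ≡ just a))

record EarData (n : ℕ) : Set where
  field
    s e   : Fin n
    inner : List (Fin n)

open EarData public

earVerts : ∀ {n} → EarData n → List (Fin n)
earVerts E = s E ∷ inner E ++ [ e E ]

-- Vertex sequence of P_j, where P₀ is the cycle and ear i is P_{i+1}.
DecV : ∀ {n t} → List (Fin n) → (Fin t → EarData n) → Fin (suc t) → List (Fin n)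
DecV P₀ ear Fin.zero    = P₀
DecV P₀ ear (Fin.suc i) = earVerts (ear i)

DecE : ∀ {n t} → List (Fin n) → (Fin t → EarData n) → Fin (suc t) → Fin n → Fin n → Set
DecE P₀ ear Fin.zero    a b = EdgeOfCycle P₀ a b
DecE P₀ ear (Fin.suc i) a b = EdgeOfPath (earVerts (ear i)) a b

-- x is a vertex of P₀ ∪ … ∪ P_i (the part built before ear i = P_{i+1})
PrevV : ∀ {n t} → List (Fin n) → (Fin t → EarData n) → Fin t → Fin n → Set
PrevV {t = t} P₀ ear i x = ∃ λ (j : Fin (suc t)) → toℕ j ≤ toℕ i × x ∈ DecV P₀ ear j

PrevE : ∀ {n t} → List (Fin n) → (Fin t → EarData n) → Fin t → Fin n → Fin n → Set
PrevE {t = t} P₀ ear i a b = ∃ λ (j : Fin (suc t)) → toℕ j ≤ toℕ i × DecE P₀ ear j a b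

record EarDecomposition {n} (G : Graph n) : Set where
  field
    t          : ℕ
    P₀         : List (Fin n)
    ear        : Fin t → EarData n
    cycle      : IsCycle G P₀
    earPath    : ∀ i → Linked (Adj G) (earVerts (ear i)) × Unique (earVerts (ear i))
    earEnds    : ∀ i → PrevV P₀ ear i (s (ear i)) × PrevV P₀ ear i (e (ear i))
    earInner   : ∀ i x → x ∈ inner (ear i) → ¬ PrevV P₀ ear i x
    earNewEdge : ∀ i a b → EdgeOfPath (earVerts (ear i)) a b → ¬ PrevE P₀ ear i a b
    coverV     : ∀ x → ∃ λ j → x ∈ DecV P₀ ear j
    coverE     : ∀ a b → Adj G a b → ∃ λ j → DecE P₀ ear j a b

  V : Fin (suc t) → List (Fin n)
  V = DecV P₀ ear

-- Attaching an ear to G: new graph on Fin (n + r), where the old vertices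
-- are i ↑ˡ r and the r new (internal) vertices w₀,…,w_{r-1} are n ↑ʳ j.
-- The ear is the path u – w₀ – w₁ – … – w_{r-1} – v (just the edge uv if r = 0).

eqᵇ : ∀ {n} → Fin n → Fin n → Bool
eqᵇ a b = ⌊ a ≟ b ⌋

module _ {n : ℕ} (G : Graph n) (u v : Fin n) (u≢v : u ≢ v) (r : ℕ) where

  earAdj : Fin n ⊎ Fin r → Fin n ⊎ Fin r → Bool
  earAdj (inj₁ a) (inj₁ b) =
    adj G a b ∨ ((r ≡ᵇ 0) ∧ ((eqᵇ a u ∧ eqᵇ b v) ∨ (eqᵇ b u ∧ eqᵇ a v)))
  earAdj (inj₁ a) (inj₂ j) = (eqᵇ a u ∧ (toℕ j ≡ᵇ 0)) ∨ (eqᵇ a v ∧ (suc (toℕ j) ≡ᵇ r))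
  earAdj (inj₂ j) (inj₁ a) = (eqᵇ a u ∧ (toℕ j ≡ᵇ 0)) ∨ (eqᵇ a v ∧ (suc (toℕ j) ≡ᵇ r))
  earAdj (inj₂ i) (inj₂ j) = (suc (toℕ i) ≡ᵇ toℕ j) ∨ (suc (toℕ j) ≡ᵇ toℕ i)

  private
    earAdj-sym : ∀ x y → earAdj x y ≡ earAdj y x
    earAdj-sym (inj₁ a) (inj₁ b) rewrite sym G a b
      | ∨-comm (eqᵇ a u ∧ eqᵇ b v) (eqᵇ b u ∧ eqᵇ a v) = refl
    earAdj-sym (inj₁ a) (inj₂ j) = refl
    earAdj-sym (inj₂ j) (inj₁ a) = refl
    earAdj-sym (inj₂ i) (inj₂ j) = ∨-comm (suc (toℕ i) ≡ᵇ toℕ j) (suc (toℕ j) ≡ᵇ toℕ i)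

    sucᵇ : ∀ k → (suc k ≡ᵇ k) ≡ false
    sucᵇ zero    = refl
    sucᵇ (suc k) = sucᵇ k

    uv-false : ∀ a → (eqᵇ a u ∧ eqᵇ a v) ≡ false
    uv-false a with a ≟ u
    ... | no _ = refl
    uv-false a | yes refl with a ≟ v
    ... | no _ = refl
    ... | yes eq = Data.Empty.⊥-elim (u≢v eq)
      where import Data.Empty

    earAdj-irrefl : ∀ x → earAdj x x ≡ false
    earAdj-irrefl (inj₁ a) rewrite irrefl G a | uv-false a = ∧-zeroʳ (r ≡ᵇ 0)
    earAdj-irrefl (inj₂ i) rewrite sucᵇ (toℕ i) = refl

  attachEar : Graph (n + r)
  attachEar = record
    { adj    = λ x y → earAdj (splitAt n x) (splitAt n y)
    ; sym    = λ x y → earAdj-sym (splitAt n x) (splitAt n y)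
    ; irrefl = λ x → earAdj-irrefl (splitAt n x)
    }

-- By Whitney's theorem G has two u–v paths A, B meeting only at their ends. With the
-- ear E they form three cycles, so |A| + |E|, |B| + |E| and |A| + |B| are ≡ k, whence
-- 2|E| ≡ k ≡ 2k′ and, m being odd, |E| ≡ k′. Any other u–v path of H runs in G and
-- closes a cycle with E, so its length is ≡ k′ as well.
--
-- For (2), suppose no ear contains both u and v. Let a be the one appearing later,
-- a new vertex of an ear P, and b the other, already in the earlier part, which has no
-- cut vertex. A fan from b to the ends of P, closed up by P and bridged by a path
-- avoiding b, gives three z₁–z₂ paths meeting only at their ends, with a and b inside
-- different ones. All three have length ≡ k′; the two a–b paths running through the
-- third one in opposite directions then have total length ≡ 4k′ but also ≡ 2k′ by (1),
-- so k ≡ 2k′ ≡ 0, contradicting 0 < k < m.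

module Submission where

open import Defs renaming (sym to adj-sym; irrefl to adj-irrefl)
open import Data.Nat using (ℕ; zero; suc; _+_; _*_; _<_; >-nonZero; _≤_; z≤n; s≤s; _≤?_; _≡ᵇ_)
open import Data.Nat.Properties using (+-cancelʳ-≡; +-suc; +-comm; <⇒≱; ≤-pred; +-mono-≤; ≤-trans; n≤1+n; ≤-reflexive; ≤-antisym; ≰⇒>; <⇒≤; +-identityʳ; m<m+n; <-irrefl; m<1+n⇒m<n∨m≡n; +-assoc; m≤n+m; m≤m+n; ≤-total; m≤n⇒m<n∨m≡n)
open import Data.Nat.Divisibility using (_∣_; divides; _∣0; ∣m+n∣m⇒∣n; ∣⇒≤; n∣m*n)
open import Data.Nat.Tactic.RingSolver using (solve-∀)
open import Data.Empty using (⊥; ⊥-elim)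
open import Data.Product using (∃; _,_; ∃₂; _×_; proj₁; proj₂; Σ)
open import Relation.Nullary using (¬_; yes; no; Dec)
open import Relation.Binary.PropositionalEquality using (_≡_; refl; sym; trans; cong; cong₂; subst; module ≡-Reasoning; _≢_)
open import Relation.Binary.Bundles using (Setoid)
open import Level using (0ℓ)
open import Data.Sum using (_⊎_; inj₁; inj₂; swap)
open import Data.List using (List; []; _∷_; _++_; [_]; length; last; map)
open import Data.List.Properties using (length-++; ++-assoc; length-map)
open import Data.Maybe using (just)
open import Data.List.Relation.Unary.Any using (here; there)
open import Data.List.Relation.Unary.All.Properties using (¬Any⇒All¬)
open import Data.List.Relation.Unary.AllPairs using ([]; _∷_)
open import Data.List.Relation.Unary.Linked using (Linked; [-]; _∷_)
open import Data.List.Relation.Unary.Unique.Propositional using (Unique)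
open import Data.List.Relation.Unary.Unique.Propositional.Properties using (Unique[x∷xs]⇒x∉xs)
open import Data.List.Relation.Binary.Disjoint.Propositional using (Disjoint)
open import Data.List.Relation.Binary.Subset.Propositional using (_⊆_)
open import Data.List.Membership.Propositional using (_∈_; _∉_)
open import Data.List.Membership.Propositional.Properties using (∈-++⁺ˡ; ∈-++⁺ʳ; ∈-++⁻; ∈-map⁻)
open import Relation.Unary using (Decidable)
open import Data.Fin using (Fin; _≟_; toℕ; fromℕ<; splitAt; _↑ˡ_; _↑ʳ_)
open import Data.Fin.Properties using (toℕ-injective; toℕ-fromℕ<; toℕ<n; splitAt-↑ˡ; splitAt-↑ʳ; splitAt⁻¹-↑ˡ; splitAt⁻¹-↑ʳ; ↑ˡ-injective; ↑ʳ-injective)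
open import Data.Bool using (Bool; true; false; _∧_; _∨_)
open import Relation.Nullary.Decidable using (_×-dec_; ¬?)
open import Data.Unit using (⊤; tt)
import Relation.Binary.Reasoning.Setoid as SetoidReasoning
import Data.List.Relation.Unary.Unique.Propositional.Properties as Unique
import Data.List.Relation.Unary.Any.Properties as Any

-- Congruence modulo m
module _ {m : ℕ} where
  open ≡-Reasoning

  ≡ₘ-refl : ∀ {a} → a ≡ₘ a [mod m ]
  ≡ₘ-refl = 0 , 0 , refl

  ≡ₘ-reflexive : ∀ {a b} → a ≡ b → a ≡ₘ b [mod m ]
  ≡ₘ-reflexive refl = ≡ₘ-refl

  ≡ₘ-sym : ∀ {a b} → a ≡ₘ b [mod m ] → b ≡ₘ a [mod m ]
  ≡ₘ-sym (p , q , eq) = q , p , sym eq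

  ≡ₘ-trans : ∀ {a b c} → a ≡ₘ b [mod m ] → b ≡ₘ c [mod m ] → a ≡ₘ c [mod m ]
  ≡ₘ-trans {a} {b} {c} (p , q , eq) (p′ , q′ , eq′) = p + p′ , q′ + q , (begin
    a + (p + p′) * m      ≡⟨ split a p p′ m ⟩
    (a + p * m) + p′ * m  ≡⟨ cong (_+ p′ * m) eq ⟩
    (b + q * m) + p′ * m  ≡⟨ exchange b q p′ m ⟩
    (b + p′ * m) + q * m  ≡⟨ cong (_+ q * m) eq′ ⟩
    (c + q′ * m) + q * m  ≡⟨ split c q′ q m ⟨
    c + (q′ + q) * m      ∎)
    where
    split : ∀ a p p′ m → a + (p + p′) * m ≡ (a + p * m) + p′ * m
    split = solve-∀
    exchange : ∀ b q p′ m → (b + q * m) + p′ * m ≡ (b + p′ * m) + q * m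
    exchange = solve-∀

  +-cong-≡ₘ : ∀ {a b c d} → a ≡ₘ b [mod m ] → c ≡ₘ d [mod m ] → a + c ≡ₘ b + d [mod m ]
  +-cong-≡ₘ {a} {b} {c} {d} (p , q , eq) (p′ , q′ , eq′) = p + p′ , q + q′ , (begin
    a + c + (p + p′) * m        ≡⟨ regroup a c p p′ m ⟩
    (a + p * m) + (c + p′ * m)  ≡⟨ cong₂ _+_ eq eq′ ⟩
    (b + q * m) + (d + q′ * m)  ≡⟨ regroup b d q q′ m ⟨
    b + d + (q + q′) * m        ∎)
    where
    regroup : ∀ a c p p′ m → a + c + (p + p′) * m ≡ (a + p * m) + (c + p′ * m)
    regroup = solve-∀

  +-cancelʳ-≡ₘ : ∀ {a b c} → a + c ≡ₘ b + c [mod m ] → a ≡ₘ b [mod m ]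
  +-cancelʳ-≡ₘ {a} {b} {c} (p , q , eq) = p , q , +-cancelʳ-≡ c (a + p * m) (b + q * m) (begin
    a + p * m + c  ≡⟨ exchange a p m c ⟩
    a + c + p * m  ≡⟨ eq ⟩
    b + c + q * m  ≡⟨ exchange b q m c ⟨
    b + q * m + c  ∎)
    where
    exchange : ∀ a p m c → a + p * m + c ≡ a + c + p * m
    exchange = solve-∀

  *-congˡ-≡ₘ : ∀ {a b} c → a ≡ₘ b [mod m ] → c * a ≡ₘ c * b [mod m ]
  *-congˡ-≡ₘ {a} {b} c (p , q , eq) = c * p , c * q , (begin
    c * a + c * p * m  ≡⟨ distrib a c p m ⟩
    c * (a + p * m)    ≡⟨ cong (c *_) eq ⟩
    c * (b + q * m)    ≡⟨ distrib b c q m ⟨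
    c * b + c * q * m  ∎)
    where
    distrib : ∀ a c p m → c * a + c * p * m ≡ c * (a + p * m)
    distrib = solve-∀

  +-*-≡ₘ : ∀ a x → a + x * m ≡ₘ a [mod m ]
  +-*-≡ₘ a x = 0 , x , identity a x m
    where
    identity : ∀ a x m → a + x * m + 0 * m ≡ a + x * m
    identity = solve-∀

≡ₘ-setoid : ℕ → Setoid 0ℓ 0ℓ
≡ₘ-setoid m = record
  { Carrier       = ℕ
  ; _≈_           = _≡ₘ_[mod m ]
  ; isEquivalence = record { refl = ≡ₘ-refl ; sym = ≡ₘ-sym ; trans = ≡ₘ-trans }
  }

module ≡ₘ-Reasoning (m : ℕ) = SetoidReasoning (≡ₘ-setoid m)

+-comm-≡ₘ : ∀ {m x y c} → x + y ≡ₘ c [mod m ] → y + x ≡ₘ c [mod m ]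
+-comm-≡ₘ {x = x} {y} h = ≡ₘ-trans (≡ₘ-reflexive (+-comm y x)) h

2∣⇒2∣2+ : ∀ {m} → 2 ∣ m → 2 ∣ 2 + m
2∣⇒2∣2+ (divides q eq) = divides (suc q) (cong (2 +_) eq)

¬2∣⇒odd : ∀ m → ¬ 2 ∣ m → ∃ λ c → m ≡ suc (c + c)
¬2∣⇒odd zero          2∤m = ⊥-elim (2∤m (2 ∣0))
¬2∣⇒odd (suc zero)    _   = 0 , refl
¬2∣⇒odd (suc (suc m)) 2∤m with ¬2∣⇒odd m (λ 2∣m → 2∤m (2∣⇒2∣2+ 2∣m))
... | c , refl = suc c , cong (λ x → suc (suc x)) (sym (+-suc c c))

odd-*2-cancel-≡ₘ : ∀ {m x y} → ¬ 2 ∣ m → 2 * x ≡ₘ 2 * y [mod m ] → x ≡ₘ y [mod m ]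
odd-*2-cancel-≡ₘ {m} {x} {y} 2∤m 2x≡2y with ¬2∣⇒odd m 2∤m
... | c , refl = begin
  x                      ≈⟨ +-*-≡ₘ x x ⟨
  x + x * suc (c + c)    ≡⟨ inverse x c ⟩
  suc c * (2 * x)        ≈⟨ *-congˡ-≡ₘ (suc c) 2x≡2y ⟩
  suc c * (2 * y)        ≡⟨ inverse y c ⟨
  y + y * suc (c + c)    ≈⟨ +-*-≡ₘ y y ⟩
  y                      ∎
  where
  open ≡ₘ-Reasoning (suc (c + c))
  -- c + 1 is the inverse of 2 modulo 2c + 1
  inverse : ∀ x c → x + x * suc (c + c) ≡ suc c * (2 * x)
  inverse = solve-∀

<-mod⇒≢ₘ0 : ∀ {k m} → 0 < k → k < m → ¬ k ≡ₘ 0 [mod m ]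
<-mod⇒≢ₘ0 {k} {m} 0<k k<m (p , q , eq) = <⇒≱ k<m (∣⇒≤ {{>-nonZero 0<k}} m∣k)
  where
  m∣k : m ∣ k
  m∣k = ∣m+n∣m⇒∣n (subst (m ∣_) (sym (trans (+-comm (p * m) k) eq)) (n∣m*n q)) (n∣m*n p)

module HalfModulus {m k k′ : ℕ} (2∤m : ¬ 2 ∣ m) (2k′≡k : 2 * k′ ≡ₘ k [mod m ]) where
  open ≡ₘ-Reasoning m

  theta-≡ₘk′ : ∀ {a b e} → a + e ≡ₘ k [mod m ] → b + e ≡ₘ k [mod m ] → a + b ≡ₘ k [mod m ] →
    e ≡ₘ k′ [mod m ]
  theta-≡ₘk′ {a} {b} {e} ae≡k be≡k ab≡k = odd-*2-cancel-≡ₘ 2∤m (≡ₘ-trans 2e≡k (≡ₘ-sym 2k′≡k))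
    where
    regroup : ∀ a b e → 2 * e + (a + b) ≡ (a + e) + (b + e)
    regroup = solve-∀
    2e≡k : 2 * e ≡ₘ k [mod m ]
    2e≡k = +-cancelʳ-≡ₘ (begin
      2 * e + (a + b)    ≡⟨ regroup a b e ⟩
      (a + e) + (b + e)  ≈⟨ +-cong-≡ₘ ae≡k be≡k ⟩
      k + k              ≈⟨ +-cong-≡ₘ (≡ₘ-refl {a = k}) ab≡k ⟨
      k + (a + b)        ∎)

  complement-≡ₘk′ : ∀ {x e} → x + e ≡ₘ k [mod m ] → e ≡ₘ k′ [mod m ] → x ≡ₘ k′ [mod m ]
  complement-≡ₘk′ {x} {e} xe≡k e≡k′ = +-cancelʳ-≡ₘ (begin
    x + k′   ≈⟨ +-cong-≡ₘ (≡ₘ-refl {a = x}) e≡k′ ⟨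
    x + e    ≈⟨ xe≡k ⟩
    k        ≈⟨ 2k′≡k ⟨
    2 * k′   ≡⟨ double k′ ⟩
    k′ + k′  ∎)
    where
    double : ∀ k′ → 2 * k′ ≡ k′ + k′
    double = solve-∀

  -- a + b and c + d split two k′-paths, t is a third; the crossing paths a t d and
  -- b t c then force 2k′ ≡ 0.
  crossing-≡ₘk′-absurd : ∀ {a b c d t} → 0 < k → k < m →
    a + b ≡ₘ k′ [mod m ] → c + d ≡ₘ k′ [mod m ] → t ≡ₘ k′ [mod m ] →
    a + t + d ≡ₘ k′ [mod m ] → b + t + c ≡ₘ k′ [mod m ] → ⊥
  crossing-≡ₘk′-absurd {a} {b} {c} {d} {t} 0<k k<m ab cd t≡k′ atd btc =
    <-mod⇒≢ₘ0 0<k k<m (begin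
      k                                ≈⟨ 2k′≡k ⟨
      2 * k′                           ≈⟨ +-cancelʳ-≡ₘ 4k′≡2k′ ⟩
      0                                ∎)
    where
    regroup : ∀ a b c d t → (a + b) + (c + d) + 2 * t ≡ (a + t + d) + (b + t + c)
    regroup = solve-∀
    four : ∀ k′ → k′ + k′ + 2 * k′ ≡ 2 * k′ + (k′ + k′)
    four = solve-∀
    4k′≡2k′ : 2 * k′ + (k′ + k′) ≡ₘ 0 + (k′ + k′) [mod m ]
    4k′≡2k′ = begin
      2 * k′ + (k′ + k′)               ≡⟨ four k′ ⟨
      k′ + k′ + 2 * k′                 ≈⟨ +-cong-≡ₘ (+-cong-≡ₘ ab cd) (*-congˡ-≡ₘ 2 t≡k′) ⟨
      (a + b) + (c + d) + 2 * t        ≡⟨ regroup a b c d t ⟩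
      (a + t + d) + (b + t + c)        ≈⟨ +-cong-≡ₘ atd btc ⟩
      k′ + k′                          ∎

-- Walks and simple paths
module _ {A : Set} where

  Unique-∷⁺ : ∀ {x : A} {xs} → x ∉ xs → Unique xs → Unique (x ∷ xs)
  Unique-∷⁺ {xs = xs} x∉xs u = ¬Any⇒All¬ xs x∉xs ∷ u

  Unique-∷⁻ : ∀ {x : A} {xs} → Unique (x ∷ xs) → Unique xs
  Unique-∷⁻ (_ ∷ u) = u

  Unique-++⁻ˡ : ∀ (xs : List A) {ys} → Unique (xs ++ ys) → Unique xs
  Unique-++⁻ˡ []       _ = []
  Unique-++⁻ˡ (x ∷ xs) u =
    Unique-∷⁺ (λ x∈xs → Unique[x∷xs]⇒x∉xs u (∈-++⁺ˡ x∈xs)) (Unique-++⁻ˡ xs (Unique-∷⁻ u))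

  Unique-++⁻ʳ : ∀ (xs : List A) {ys} → Unique (xs ++ ys) → Unique ys
  Unique-++⁻ʳ []       u = u
  Unique-++⁻ʳ (x ∷ xs) u = Unique-++⁻ʳ xs (Unique-∷⁻ u)

  Unique-++⇒Disjoint : ∀ (xs : List A) {ys} → Unique (xs ++ ys) → Disjoint xs ys
  Unique-++⇒Disjoint (x ∷ xs) u (here refl , y∈ys) = Unique[x∷xs]⇒x∉xs u (∈-++⁺ʳ xs y∈ys)
  Unique-++⇒Disjoint (x ∷ xs) u (there y∈xs , y∈ys) = Unique-++⇒Disjoint xs (Unique-∷⁻ u) (y∈xs , y∈ys)

-- Walk E a xs b: a walk a, x₁, …, xₙ = b along E, recorded by its vertices after a.
data Walk {A : Set} (E : A → A → Set) : A → List A → A → Set where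
  []  : ∀ {a} → Walk E a [] a
  _∷_ : ∀ {a b xs c} → E a b → Walk E b xs c → Walk E a (b ∷ xs) c

SimplePath : {A : Set} (E : A → A → Set) → A → List A → A → Set
SimplePath E a xs b = Walk E a xs b × Unique (a ∷ xs)

module _ {A : Set} {E : A → A → Set} where

  _++ʷ_ : ∀ {a b c xs ys} → Walk E a xs b → Walk E b ys c → Walk E a (xs ++ ys) c
  []      ++ʷ w′ = w′
  (e ∷ w) ++ʷ w′ = e ∷ (w ++ʷ w′)

  Walk-map : ∀ {E′ : A → A → Set} → (∀ {x y} → E x y → E′ x y) →
    ∀ {a b xs} → Walk E a xs b → Walk E′ a xs b
  Walk-map f []      = []
  Walk-map f (e ∷ w) = f e ∷ Walk-map f w

  target∈ : ∀ {a b xs} → Walk E a xs b → b ∈ a ∷ xs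
  target∈ []      = here refl
  target∈ (e ∷ w) = there (target∈ w)

  ≢⇒target∈ : ∀ {a b xs} → Walk E a xs b → a ≢ b → b ∈ xs
  ≢⇒target∈ w a≢b with target∈ w
  ... | here b≡a  = ⊥-elim (a≢b (sym b≡a))
  ... | there b∈  = b∈

  visited-targets : ∀ {V : A → Set} → (∀ {x y} → E x y → V y) →
    ∀ {a b xs w} → Walk E a xs b → w ∈ xs → V w
  visited-targets f (e ∷ w) (here refl) = f e
  visited-targets f (e ∷ w) (there w∈) = visited-targets f w w∈

  ≢⇒1≤length : ∀ {a b xs} → Walk E a xs b → a ≢ b → 1 ≤ length xs
  ≢⇒1≤length []      a≢b = ⊥-elim (a≢b refl)
  ≢⇒1≤length (_ ∷ _) _   = s≤s z≤n

  splitWalk : ∀ {a b z xs} → Walk E a xs b → z ∈ a ∷ xs →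
    ∃₂ λ xs₁ xs₂ → xs ≡ xs₁ ++ xs₂ × Walk E a xs₁ z × Walk E z xs₂ b
  splitWalk {xs = xs} w (here refl) = [] , xs , refl , [] , w
  splitWalk (e ∷ w) (there z∈) with splitWalk w z∈
  ... | xs₁ , xs₂ , refl , w₁ , w₂ = _ ∷ xs₁ , xs₂ , refl , e ∷ w₁ , w₂

  []⊎∷ʳ : ∀ {a b xs} → Walk E a xs b → xs ≡ [] ⊎ ∃ λ ys → xs ≡ ys ++ [ b ]
  []⊎∷ʳ [] = inj₁ refl
  []⊎∷ʳ (e ∷ []) = inj₂ ([] , refl)
  []⊎∷ʳ (_∷_ {b = b} e w@(_ ∷ _)) with []⊎∷ʳ w
  ... | inj₂ (ys , eq) = inj₂ (b ∷ ys , cong (b ∷_) eq)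

  unsnocWalk : ∀ {a c d} ws → Walk E a (ws ++ [ c ]) d → c ≡ d × ∃ λ z → Walk E a ws z × E z c
  unsnocWalk []       (e ∷ [])  = refl , _ , [] , e
  unsnocWalk (x ∷ ws) (e ∷ w) with unsnocWalk ws w
  ... | c≡d , z , w′ , e′ = c≡d , z , e ∷ w′ , e′

  Walk⇒Linked : ∀ {a b xs} → Walk E a xs b → Linked E (a ∷ xs) × last (a ∷ xs) ≡ just b
  Walk⇒Linked []      = [-] , refl
  Walk⇒Linked (e ∷ w) with Walk⇒Linked w
  ... | linked , end = e ∷ linked , end

  Linked⇒Walk : ∀ {a b} xs → Linked E (a ∷ xs) → last (a ∷ xs) ≡ just b → Walk E a xs b
  Linked⇒Walk []       [-]            refl = []
  Linked⇒Walk (x ∷ xs) (e ∷ linked) end  = e ∷ Linked⇒Walk xs linked end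

  firstHit : ∀ {P : A → Set} → Decidable P → ∀ {a b xs} → Walk E a xs b → P b →
    ∃ λ z → ∃₂ λ xs₁ xs₂ → xs ≡ xs₁ ++ xs₂ × Walk E a xs₁ z × Walk E z xs₂ b × P z ×
      (∀ {w} → w ∈ a ∷ xs₁ → P w → w ≡ z)
  firstHit P? {a} {xs = xs} w Pb with P? a
  ... | yes Pa = a , [] , xs , refl , [] , w , Pa , λ { (here refl) _ → refl }
  firstHit P? [] Pb | no ¬Pa = ⊥-elim (¬Pa Pb)
  firstHit P? (e ∷ w) Pb | no ¬Pa with firstHit P? w Pb
  ... | z , xs₁ , xs₂ , refl , w₁ , w₂ , Pz , first =
    z , _ ∷ xs₁ , xs₂ , refl , e ∷ w₁ , w₂ , Pz ,
      λ { (here refl) Pw → ⊥-elim (¬Pa Pw) ; (there w∈) Pw → first w∈ Pw }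

  joinPath : ∀ {a b c xs ys} → SimplePath E a xs b → SimplePath E b ys c → Disjoint (a ∷ xs) ys →
    SimplePath E a (xs ++ ys) c
  joinPath (w , u) (w′ , u′) disj = w ++ʷ w′ , Unique.++⁺ u (Unique-∷⁻ u′) disj

  splitPath : ∀ {a b z xs} → SimplePath E a xs b → z ∈ a ∷ xs →
    ∃₂ λ xs₁ xs₂ → xs ≡ xs₁ ++ xs₂ × SimplePath E a xs₁ z × SimplePath E z xs₂ b × Disjoint (a ∷ xs₁) xs₂
  splitPath {a} (w , u) z∈ with splitWalk w z∈
  ... | xs₁ , xs₂ , refl , w₁ , w₂ =
    xs₁ , xs₂ , refl , (w₁ , Unique-++⁻ˡ (a ∷ xs₁) u) ,
    (w₂ , Unique-∷⁺ (λ z∈xs₂ → Unique-++⇒Disjoint (a ∷ xs₁) u (target∈ w₁ , z∈xs₂)) (Unique-++⁻ʳ (a ∷ xs₁) u)) ,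
    Unique-++⇒Disjoint (a ∷ xs₁) u

  closedPath⇒[] : ∀ {a xs} → SimplePath E a xs a → xs ≡ []
  closedPath⇒[] ([] , _)    = refl
  closedPath⇒[] (e ∷ w , u) = ⊥-elim (Unique[x∷xs]⇒x∉xs u (target∈ w))

  record Reversal (a : A) (xs : List A) (b : A) : Set where
    constructor reversal
    field
      tail     : List A
      path     : SimplePath E b tail a
      ⊆forward : b ∷ tail ⊆ a ∷ xs
      length≡  : length tail ≡ length xs

  module _ (E-sym : ∀ {x y} → E x y → E y x) where

    reverseWalk : ∀ {a b xs} → Walk E a xs b → Unique (a ∷ xs) → Reversal a xs b
    reverseWalk [] u = reversal [] ([] , u) (λ x∈ → x∈) refl
    reverseWalk {a} {b} (_∷_ {b = c} {xs = xs} e w) u with reverseWalk w (Unique-∷⁻ u)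
    ... | reversal ys (w′ , u′) ⊆fwd len =
      reversal (ys ++ [ a ]) (w′ ++ʷ (E-sym e ∷ []) , Unique.++⁺ u′ (Unique-∷⁺ (λ ()) []) a∉)
        ⊆fwd′ (trans (length-++ ys) (trans (+-comm (length ys) 1) (cong suc len)))
      where
      a∉ : Disjoint (b ∷ ys) [ a ]
      a∉ (a∈ , here refl) = Unique[x∷xs]⇒x∉xs u (⊆fwd a∈)
      ⊆fwd′ : b ∷ ys ++ [ a ] ⊆ a ∷ c ∷ xs
      ⊆fwd′ x∈ with ∈-++⁻ (b ∷ ys) x∈
      ... | inj₁ x∈ys       = there (⊆fwd x∈ys)
      ... | inj₂ (here refl) = here refl

    reversePath : ∀ {a b xs} → SimplePath E a xs b → Reversal a xs b
    reversePath (w , u) = reverseWalk w u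

-- the tails of two walks from a common start, sharing only their common end b
MeetOnlyAt : {A : Set} → A → List A → List A → Set
MeetOnlyAt b xs ys = ∀ {w} → w ∈ xs → w ∈ ys → w ≡ b

module _ {n : ℕ} (G : Graph n) where

  Adj-sym : ∀ {a b} → Adj G a b → Adj G b a
  Adj-sym {a} {b} ab = trans (adj-sym G b a) ab

  Adj-irrefl : ∀ {a} → ¬ Adj G a a
  Adj-irrefl {a} aa with trans (sym aa) (adj-irrefl G a)
  ... | ()

  SimplePath⇒Path : ∀ {a b xs} → SimplePath (Adj G) a xs b → Σ (Path G a b) λ p → pathLength p ≡ length xs
  SimplePath⇒Path {a} {xs = xs} (w , u) with Walk⇒Linked w
  ... | linked , end = record { verts = a ∷ xs ; linked = linked ; unique = u ; start = refl ; end = end } , refl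

  Path⇒SimplePath : ∀ {a b} (p : Path G a b) →
    ∃ λ xs → SimplePath (Adj G) a xs b × pathLength p ≡ length xs × verts p ≡ a ∷ xs
  Path⇒SimplePath record { verts = x ∷ xs ; linked = linked ; unique = u ; start = refl ; end = end } =
    xs , (Linked⇒Walk xs linked end , u) , refl , refl

  closedWalk⇒IsCycle : ∀ {a} ws → Walk (Adj G) a (ws ++ [ a ]) a → Unique (a ∷ ws) → 2 ≤ length ws →
    IsCycle G (a ∷ ws)
  closedWalk⇒IsCycle {a} ws w u 2≤ with unsnocWalk ws w
  ... | _ , z , w′ , za with Walk⇒Linked w′
  ... | linked , end = s≤s 2≤ , linked , u , a , z , refl , end , za

  module _ {k m : ℕ} (cycles : AllCyclesMod G k m) where

    -- Two a–b paths meeting only at their ends close up into a cycle.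
    meetOnlyAt-≡ₘk : ∀ {a b xs ys} → a ≢ b → SimplePath (Adj G) a xs b → SimplePath (Adj G) a ys b →
      MeetOnlyAt b xs ys → 3 ≤ length xs + length ys → length xs + length ys ≡ₘ k [mod m ]
    meetOnlyAt-≡ₘk a≢b P Q meet 3≤ with reversePath Adj-sym Q
    ... | reversal rys (rw , ru) ⊆Q len with []⊎∷ʳ rw
    ... | inj₁ refl with rw
    ...   | [] = ⊥-elim (a≢b refl)
    meetOnlyAt-≡ₘk {a} {b} {xs} {ys} a≢b P Q meet 3≤
        | reversal rys (rw , ru) ⊆Q len | inj₂ (zs , refl) =
      ≡ₘ-trans (≡ₘ-reflexive (sym length≡)) (cycles (a ∷ xs ++ zs) cycle)
      where
      b∉zs : b ∉ zs
      b∉zs b∈ = Unique[x∷xs]⇒x∉xs ru (∈-++⁺ˡ b∈)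
      a∉zs : a ∉ zs
      a∉zs a∈ = Unique-++⇒Disjoint zs (Unique-∷⁻ ru) (a∈ , here refl)
      zs⊆ys : ∀ {w} → w ∈ zs → w ∈ ys
      zs⊆ys w∈ with ⊆Q (there (∈-++⁺ˡ w∈))
      ... | here refl = ⊥-elim (a∉zs w∈)
      ... | there w∈ys = w∈ys
      disjoint : Disjoint (a ∷ xs) zs
      disjoint (here refl , a∈)  = a∉zs a∈
      disjoint (there w∈ , w∈zs) with meet w∈ (zs⊆ys w∈zs)
      ... | refl = b∉zs w∈zs
      length≡ : length (a ∷ xs ++ zs) ≡ length xs + length ys
      length≡ = begin
        suc (length (xs ++ zs))         ≡⟨ cong suc (length-++ xs) ⟩
        suc (length xs + length zs)     ≡⟨ +-suc (length xs) (length zs) ⟨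
        length xs + suc (length zs)     ≡⟨ cong (length xs +_) (trans (+-comm 1 (length zs)) (sym (length-++ zs))) ⟩
        length xs + length (zs ++ [ a ]) ≡⟨ cong (length xs +_) len ⟩
        length xs + length ys           ∎
        where open ≡-Reasoning
      cycle : IsCycle G (a ∷ xs ++ zs)
      cycle = closedWalk⇒IsCycle (xs ++ zs)
        (subst (λ l → Walk (Adj G) a l a) (sym (++-assoc xs zs [ a ])) (proj₁ P ++ʷ rw))
        (Unique.++⁺ (proj₂ P) (Unique-++⁻ˡ zs (Unique-∷⁻ ru)) disjoint)
        (≤-pred (subst (3 ≤_) (sym length≡) 3≤))

-- Graphs without a cut vertex
module Induced {n : ℕ} (G : Graph n) (V : Fin n → Set) where
  open import Data.List.Membership.DecPropositional (_≟_ {n}) using (_∈?_)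

  AdjIn : Fin n → Fin n → Set
  AdjIn a b = Adj G a b × V a × V b

  AdjIn-sym : ∀ {a b} → AdjIn a b → AdjIn b a
  AdjIn-sym (ab , Va , Vb) = Adj-sym G ab , Vb , Va

  PathIn : Fin n → List (Fin n) → Fin n → Set
  PathIn = SimplePath AdjIn

  reverseIn : ∀ {a b xs} → PathIn a xs b → Reversal a xs b
  reverseIn = reversePath AdjIn-sym

  NoCutVertex : Set
  NoCutVertex = ∀ x a b → V a → V b → a ≢ x → b ≢ x → ∃ λ xs → PathIn a xs b × x ∉ a ∷ xs

  ThirdVertex : Set
  ThirdVertex = ∀ a b → ∃ λ w → V w × w ≢ a × w ≢ b

  PathIn⇒V : ∀ {a b xs w} → V a → PathIn a xs b → w ∈ a ∷ xs → V w
  PathIn⇒V Va P (here refl) = Va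
  PathIn⇒V Va P (there w∈)  = visited-targets (λ ab → proj₂ (proj₂ ab)) (proj₁ P) w∈

  PathIn⇒SimplePath : ∀ {a b xs} → PathIn a xs b → SimplePath (Adj G) a xs b
  PathIn⇒SimplePath (w , u) = Walk-map proj₁ w , u

  Theta : Fin n → Fin n → Set
  Theta a b = ∃₂ λ xs ys → PathIn a xs b × PathIn a ys b × MeetOnlyAt b xs ys × 3 ≤ length xs + length ys

  -- follow A up to z, then R
  reroute : ∀ {u a z b xa xb rs} → PathIn u xa a → PathIn u xb a → MeetOnlyAt a xa xb →
    z ∈ u ∷ xa → z ≢ a → PathIn z rs b → MeetOnlyAt z (z ∷ rs) (u ∷ xa ++ xb) →
    ∃ λ xs → PathIn u xs b × MeetOnlyAt u (u ∷ xs) (u ∷ xb)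
  reroute {u} {a} {z} {xb = xb} {rs} A B meet z∈A z≢a R leaves with splitPath A z∈A
  ... | xa₁ , xa₂ , refl , A₁ , A₂ , disjA = xa₁ ++ rs , joinPath A₁ R disjoint , meetB
    where
    z∉rs : z ∉ rs
    z∉rs = Unique[x∷xs]⇒x∉xs (proj₂ R)
    disjoint : Disjoint (u ∷ xa₁) rs
    disjoint (w∈A₁ , w∈R) with leaves (there w∈R) (∈-++⁺ˡ (∈-++⁺ˡ w∈A₁))
    ... | refl = z∉rs w∈R
    a∉A₁ : a ∉ u ∷ xa₁
    a∉A₁ a∈ with target∈ (proj₁ A₂)
    ... | here refl  = z≢a refl
    ... | there a∈A₂ = disjA (a∈ , a∈A₂)
    meetB : MeetOnlyAt u (u ∷ xa₁ ++ rs) (u ∷ xb)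
    meetB w∈ w∈B with ∈-++⁻ (u ∷ xa₁) w∈
    meetB _ _           | inj₁ (here refl) = refl
    meetB _ (here refl) | inj₁ (there _)   = refl
    meetB _ (there w∈B) | inj₁ (there w∈A₁) with meet (∈-++⁺ˡ w∈A₁) w∈B
    ... | refl = ⊥-elim (a∉A₁ (there w∈A₁))
    meetB _ w∈B | inj₂ w∈R with leaves (there w∈R) (B⊆ w∈B)
      where
      B⊆ : ∀ {w} → w ∈ u ∷ xb → w ∈ u ∷ (xa₁ ++ xa₂) ++ xb
      B⊆ (here refl) = here refl
      B⊆ (there w∈)  = there (∈-++⁺ʳ (xa₁ ++ xa₂) w∈)
    ... | refl = ⊥-elim (z∉rs w∈R)

  AdjIn⇒≢ : ∀ {a b} → AdjIn a b → a ≢ b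
  AdjIn⇒≢ (ab , _) refl = Adj-irrefl G ab

  edgePath : ∀ {a b} → AdjIn a b → PathIn a [ b ] b
  edgePath ab = ab ∷ [] , Unique-∷⁺ (λ { (here refl) → AdjIn⇒≢ ab refl }) (Unique-∷⁺ (λ ()) [])

  Theta⇒≢ : ∀ {a b} → Theta a b → a ≢ b
  Theta⇒≢ (xs , ys , P , Q , _ , 3≤) refl with closedPath⇒[] P | closedPath⇒[] Q
  Theta⇒≢ (_ , _ , _ , _ , _ , ()) refl | refl | refl

  -- the second side of the new theta is B followed by ab
  extendTheta : ∀ {u a b xa xb} → AdjIn a b → b ≢ u → u ≢ a →
    PathIn u xa a → PathIn u xb a → MeetOnlyAt a xa xb →
    (∃ λ xs → PathIn u xs b × MeetOnlyAt u (u ∷ xs) (u ∷ xb)) → Theta u b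
  extendTheta {u} {b = b} {xb = xb} ab b≢u u≢a A B _ (xs , P , meet) =
    xs , xb ++ [ b ] , P , B′ , meet′ , 3≤
    where
    b∉B : b ∉ u ∷ xb
    b∉B b∈ = b≢u (meet (target∈ (proj₁ P)) b∈)
    B′ : PathIn u (xb ++ [ b ]) b
    B′ = joinPath B (edgePath ab) λ { (b∈ , here refl) → b∉B b∈ }
    meet′ : MeetOnlyAt b xs (xb ++ [ b ])
    meet′ w∈P w∈B′ with ∈-++⁻ xb w∈B′
    ... | inj₂ (here refl) = refl
    ... | inj₁ w∈B with meet (there w∈P) (there w∈B)
    ...   | refl = ⊥-elim (Unique[x∷xs]⇒x∉xs (proj₂ B) w∈B)
    3≤ : 3 ≤ length xs + length (xb ++ [ b ])
    3≤ = subst (λ l → 3 ≤ length xs + l) (sym (trans (length-++ xb) (+-comm _ 1)))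
           (subst (3 ≤_) (sym (+-suc (length xs) (length xb)))
             (s≤s (+-mono-≤ (≢⇒1≤length (proj₁ P) (λ eq → b≢u (sym eq))) (≢⇒1≤length (proj₁ B) u≢a))))

  Fan : Fin n → Fin n → Fin n → Set
  Fan x v y = ∃₂ λ fs gs → PathIn x fs v × PathIn v gs y × Disjoint (x ∷ fs) gs

  meetOnlyAt⇒Fan : ∀ {x v y xs ys} → PathIn v xs x → PathIn v ys y → MeetOnlyAt v (v ∷ ys) (v ∷ xs) →
    Fan x v y
  meetOnlyAt⇒Fan {ys = ys} X Y meet with reverseIn X
  ... | reversal rxs RX RX⊆ _ = rxs , ys , RX , Y , disjoint
    where
    disjoint : Disjoint (_ ∷ rxs) ys
    disjoint (w∈RX , w∈Y) with meet (there w∈Y) (RX⊆ w∈RX)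
    ... | refl = Unique[x∷xs]⇒x∉xs (proj₂ Y) w∈Y

  module _ (noCut : NoCutVertex) where

    -- A path from b to u avoiding a first meets the u–a theta A ∪ B at some z ≠ a;
    -- rerouting the side containing z gives a u–b path that avoids the other side.
    rerouteTheta : ∀ {u a b xa xb} → V u → V b → u ≢ a → b ≢ a →
      PathIn u xa a → PathIn u xb a → MeetOnlyAt a xa xb →
      (∃ λ xs → PathIn u xs b × MeetOnlyAt u (u ∷ xs) (u ∷ xb)) ⊎
      (∃ λ xs → PathIn u xs b × MeetOnlyAt u (u ∷ xs) (u ∷ xa))
    rerouteTheta {u} {a} {b} {xa} {xb} Vu Vb u≢a b≢a A B meet with noCut a b u Vb Vu b≢a u≢a
    ... | qs , Q , a∉Q with firstHit (λ x → x ∈? (u ∷ xa ++ xb)) (proj₁ Q) (here refl)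
    ... | z , qs₁ , qs₂ , refl , Q₁ , _ , z∈AB , first
        with reverseIn (Q₁ , Unique-++⁻ˡ (b ∷ qs₁) (proj₂ Q)) | ∈-++⁻ (u ∷ xa) z∈AB
    ... | reversal rs R R⊆ _ | inj₁ z∈A =
      inj₁ (reroute A B meet z∈A z≢a R (λ w∈R w∈AB → first (R⊆ w∈R) w∈AB))
      where
      z≢a : z ≢ a
      z≢a refl = a∉Q (∈-++⁺ˡ (target∈ Q₁))
    ... | reversal rs R R⊆ _ | inj₂ z∈B =
      inj₂ (reroute B A (λ w∈B w∈A → meet w∈A w∈B) (there z∈B) z≢a R
              (λ w∈R w∈BA → first (R⊆ w∈R) (reorder w∈BA)))
      where
      z≢a : z ≢ a
      z≢a refl = a∉Q (∈-++⁺ˡ (target∈ Q₁))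
      reorder : ∀ {w} → w ∈ u ∷ xb ++ xa → w ∈ u ∷ xa ++ xb
      reorder (here refl) = here refl
      reorder (there w∈)  = there (Any.++-comm xb xa w∈)

    Theta-step : ∀ {u a b} → V u → Theta u a → AdjIn a b → b ≢ u → Theta u b
    Theta-step Vu θ@(xa , xb , A , B , meet , _) ab@(_ , _ , Vb) b≢u
      with rerouteTheta Vu Vb u≢a (λ b≡a → AdjIn⇒≢ ab (sym b≡a)) A B meet
      where u≢a = Theta⇒≢ θ
    ... | inj₁ P = extendTheta ab b≢u (Theta⇒≢ θ) A B meet P
    ... | inj₂ P = extendTheta ab b≢u (Theta⇒≢ θ) B A (λ w∈B w∈A → meet w∈A w∈B) P

    Theta-along : ∀ {u a v xs} → V u → Walk AdjIn a xs v → u ∉ xs → Theta u a → Theta u v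
    Theta-along Vu []       _   θ = θ
    Theta-along Vu (ab ∷ w) u∉ θ =
      Theta-along Vu w (λ u∈ → u∉ (there u∈)) (Theta-step Vu θ ab (λ b≡u → u∉ (here (sym b≡u))))

    module _ (third : ThirdVertex) where

      -- A third vertex w, a b–w path S avoiding u and a u–w path T avoiding b: T up to
      -- its first meeting z with S, then S back to b, together with the edge ub.
      edge⇒Theta : ∀ {u b} → AdjIn u b → Theta u b
      edge⇒Theta {u} {b} ub@(_ , Vu , Vb) with third u b
      ... | w , Vw , w≢u , w≢b with noCut u b w Vb Vw (λ b≡u → AdjIn⇒≢ ub (sym b≡u)) w≢u
      ... | ss , S , u∉S with noCut b u w Vu Vw (AdjIn⇒≢ ub) w≢b
      ... | ts , T , b∉T with firstHit (λ x → x ∈? (b ∷ ss)) (proj₁ T) (target∈ (proj₁ S))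
      ... | z , ts₁ , _ , refl , T₁ , _ , z∈S , first with splitPath S z∈S
      ... | ss₁ , _ , refl , S₁ , _ , _ with reverseIn S₁
      ... | reversal rs R R⊆ _ =
        ts₁ ++ rs , [ b ] , joinPath T₁′ R disjoint , edgePath ub ,
        (λ { _ (here refl) → refl }) , 3≤
        where
        T₁′ : PathIn u ts₁ z
        T₁′ = T₁ , Unique-++⁻ˡ (u ∷ ts₁) (proj₂ T)
        disjoint : Disjoint (u ∷ ts₁) rs
        disjoint (w∈T , w∈R) with first w∈T (∈-++⁺ˡ (R⊆ (there w∈R)))
        ... | refl = Unique[x∷xs]⇒x∉xs (proj₂ R) w∈R
        z≢u : z ≢ u
        z≢u refl = u∉S z∈S
        z≢b : z ≢ b
        z≢b refl = b∉T (∈-++⁺ˡ (target∈ T₁))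
        3≤ : 3 ≤ length (ts₁ ++ rs) + 1
        3≤ = subst (3 ≤_) (sym (trans (cong (_+ 1) (length-++ ts₁)) (+-comm _ 1)))
               (s≤s (+-mono-≤ (≢⇒1≤length T₁ (λ u≡z → z≢u (sym u≡z))) (≢⇒1≤length (proj₁ R) z≢b)))

      whitney : ∀ {u v} → V u → V v → u ≢ v → Theta u v
      whitney {u} {v} Vu Vv u≢v with third u v
      ... | w , _ , w≢u , w≢v with noCut w u v Vu Vv (λ u≡w → w≢u (sym u≡w)) (λ v≡w → w≢v (sym v≡w))
      ... | _ , ([] , _)      , _ = ⊥-elim (u≢v refl)
      ... | _ , (ub ∷ P , uP) , _ = Theta-along Vu P (λ u∈ → Unique[x∷xs]⇒x∉xs uP (there u∈)) (edge⇒Theta ub)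

      fan : ∀ {x v y} → V x → V v → V y → x ≢ v → y ≢ v → x ≢ y → Fan x v y
      fan Vx Vv Vy x≢v y≢v x≢y with whitney Vv Vx (λ v≡x → x≢v (sym v≡x))
      ... | _ , _ , A , B , meet , _
          with rerouteTheta Vv Vy (λ v≡x → x≢v (sym v≡x)) (λ y≡x → x≢y (sym y≡x)) A B meet
      ... | inj₁ (ys , Y , meetY) = meetOnlyAt⇒Fan B Y meetY
      ... | inj₂ (ys , Y , meetY) = meetOnlyAt⇒Fan A Y meetY

-- Adding ears
module AddEar {n : ℕ} (G : Graph n) (V : Fin n → Set) (s e : Fin n) (inner : List (Fin n)) where
  open import Data.List.Membership.DecPropositional (_≟_ {n}) using (_∈?_)

  ws : List (Fin n)
  ws = inner ++ [ e ]

  V⁺ : Fin n → Set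
  V⁺ x = V x ⊎ x ∈ s ∷ ws

  module Old = Induced G V
  module New = Induced G V⁺

  lift : ∀ {a b xs} → Old.PathIn a xs b → New.PathIn a xs b
  lift (w , u) = Walk-map (λ { (ab , Va , Vb) → ab , inj₁ Va , inj₁ Vb }) w , u

  module _ (noCut : Old.NoCutVertex) (ear : New.PathIn s ws e) (Vs : V s) (Ve : V e)
           (innerNew : ∀ {w} → w ∈ inner → ¬ V w) where

    OldOnlyAtEnds : List (Fin n) → Set
    OldOnlyAtEnds xs = ∀ {w} → w ∈ xs → V w → w ≡ s ⊎ w ≡ e

    ear-oldOnlyAtEnds : OldOnlyAtEnds (s ∷ ws)
    ear-oldOnlyAtEnds (here refl) _ = inj₁ refl
    ear-oldOnlyAtEnds (there w∈) Vw with ∈-++⁻ inner w∈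
    ... | inj₁ w∈inner    = ⊥-elim (innerNew w∈inner Vw)
    ... | inj₂ (here refl) = inj₂ refl

    old⊎inner : ∀ {a} → V⁺ a → V a ⊎ (a ∈ ws × ¬ V a)
    old⊎inner (inj₁ Va)          = inj₁ Va
    old⊎inner (inj₂ (here refl)) = inj₁ Vs
    old⊎inner (inj₂ (there a∈)) with ∈-++⁻ inner a∈
    ... | inj₁ a∈inner    = inj₂ (a∈ , innerNew a∈inner)
    ... | inj₂ (here refl) = inj₁ Ve

    Avoiding : Fin n → Fin n → Fin n → Set
    Avoiding x a b = ∃ λ xs → New.PathIn a xs b × x ∉ a ∷ xs

    reverseAvoiding : ∀ {x a b} → Avoiding x a b → Avoiding x b a
    reverseAvoiding (_ , P , x∉) with New.reverseIn P
    ... | reversal ys Q Q⊆ _ = ys , Q , λ x∈ → x∉ (Q⊆ x∈)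

    record EarSplit (a : Fin n) : Set where
      field
        before after : List (Fin n)
        oldAtEnds    : OldOnlyAtEnds (s ∷ before ++ after)
        toA          : New.PathIn s before a
        fromA        : New.PathIn a after e
        disjoint     : Disjoint (s ∷ before) after
        covers       : ∀ {w} → w ∈ ws → w ∈ s ∷ before ++ after

    splitEar : ∀ {a} → a ∈ ws → EarSplit a
    splitEar a∈ with splitPath ear (there a∈)
    ... | xs₁ , xs₂ , eq , P₁ , P₂ , disj = record
      { before    = xs₁
      ; after     = xs₂
      ; oldAtEnds = λ {w} w∈ → ear-oldOnlyAtEnds (subst (λ l → w ∈ s ∷ l) (sym eq) w∈)
      ; toA       = P₁
      ; fromA     = P₂
      ; disjoint  = disj
      ; covers    = λ {w} w∈ → subst (λ l → w ∈ s ∷ l) eq (there w∈)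
      }

    module _ {a : Fin n} (split : EarSplit a) (¬Va : ¬ V a) where
      open EarSplit split

      e∉before : e ∉ s ∷ before
      e∉before e∈ with target∈ (proj₁ fromA)
      ... | here refl    = ¬Va Ve
      ... | there e∈after = disjoint (e∈ , e∈after)

      -- leave the ear through whichever end is not cut off by x
      innerToOld : ∀ {b x} → V b → a ≢ x → b ≢ x → Avoiding x a b
      innerToOld {b} {x} Vb a≢x b≢x with x ∈? (s ∷ before)
      ... | no x∉before with New.reverseIn toA | noCut x s b Vs Vb (λ s≡x → x∉before (here (sym s≡x))) b≢x
      ...   | reversal rs R R⊆ _ | os , O , x∉O = rs ++ os , joinPath R (lift O) disj , avoids
        where
        disj : Disjoint (a ∷ rs) os
        disj (w∈R , w∈O) with oldAtEnds (∈-++⁺ˡ (R⊆ w∈R)) (Old.PathIn⇒V Vs O (there w∈O))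
        ... | inj₁ refl = Unique[x∷xs]⇒x∉xs (proj₂ O) w∈O
        ... | inj₂ refl = e∉before (R⊆ w∈R)
        avoids : x ∉ a ∷ rs ++ os
        avoids x∈ with ∈-++⁻ (a ∷ rs) x∈
        ... | inj₁ x∈R = x∉before (R⊆ x∈R)
        ... | inj₂ x∈O = x∉O (there x∈O)
      innerToOld {b} {x} Vb a≢x b≢x | yes x∈before with noCut x e b Ve Vb e≢x b≢x
        where
        e≢x : e ≢ x
        e≢x refl = e∉before x∈before
      ... | os , O , x∉O = after ++ os , joinPath fromA (lift O) disj , avoids
        where
        disj : Disjoint (a ∷ after) os
        disj {w} (w∈A , w∈O) with oldAtEnds (onEar w∈A) (Old.PathIn⇒V Ve O (there w∈O))
          where
          onEar : w ∈ a ∷ after → w ∈ s ∷ before ++ after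
          onEar (here refl) = ∈-++⁺ˡ (target∈ (proj₁ toA))
          onEar (there w∈)  = there (∈-++⁺ʳ before w∈)
        ... | inj₂ refl = Unique[x∷xs]⇒x∉xs (proj₂ O) w∈O
        disj (here refl , _)   | inj₁ refl = ¬Va Vs
        disj (there w∈A , _)   | inj₁ refl = disjoint (here refl , w∈A)
        avoids : x ∉ a ∷ after ++ os
        avoids x∈ with ∈-++⁻ (a ∷ after) x∈
        ... | inj₁ (here refl)   = a≢x refl
        ... | inj₁ (there x∈A)   = disjoint (x∈before , x∈A)
        ... | inj₂ x∈O           = x∉O (there x∈O)

      beforeMeetsAfter : ∀ {w} → w ∈ s ∷ before → w ∈ a ∷ after → w ≡ a
      beforeMeetsAfter _   (here w≡a)    = w≡a
      beforeMeetsAfter w∈ (there w∈after) = ⊥-elim (disjoint (w∈ , w∈after))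

      -- b lies further along the ear: follow the ear, or go around through the old part
      innerToLater : ∀ {b x} → ¬ V b → b ∈ after → a ≢ x → b ≢ x → Avoiding x a b
      innerToLater {x = x} ¬Vb b∈after a≢x b≢x with splitPath fromA (there b∈after)
      ... | mid , rest , refl , A→B , B→E , disjAB with x ∈? (a ∷ mid)
      ... | no x∉mid = mid , A→B , x∉mid
      ... | yes x∈mid with New.reverseIn toA | New.reverseIn B→E | noCut x s e Vs Ve s≢x e≢x
        where
        s≢x : s ≢ x
        s≢x refl = ¬Va (subst V (beforeMeetsAfter (here refl) (∈-++⁺ˡ x∈mid)) Vs)
        e≢x : e ≢ x
        e≢x refl with target∈ (proj₁ B→E)
        ... | here refl     = ¬Vb Ve
        ... | there e∈rest  = disjAB (x∈mid , e∈rest)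
      ... | reversal rs R R⊆ _ | reversal rs′ R′ R′⊆ _ | os , O , x∉O =
        rs ++ (os ++ rs′) , joinPath R (joinPath (lift O) R′ disjOR′) disjR , avoids
        where
        rs′⊆after : ∀ {w} → w ∈ rs′ → w ∈ mid ++ rest
        rs′⊆after w∈ with R′⊆ (there w∈)
        ... | here refl   = b∈after
        ... | there w∈rest = ∈-++⁺ʳ mid w∈rest
        disjOR′ : Disjoint (s ∷ os) rs′
        disjOR′ (w∈O , w∈R′) with oldAtEnds (there (∈-++⁺ʳ before (rs′⊆after w∈R′))) (Old.PathIn⇒V Vs O w∈O)
        ... | inj₁ refl = disjoint (here refl , rs′⊆after w∈R′)
        ... | inj₂ refl = Unique[x∷xs]⇒x∉xs (proj₂ R′) w∈R′
        disjR : Disjoint (a ∷ rs) (os ++ rs′)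
        disjR (w∈R , w∈OR′) with ∈-++⁻ os w∈OR′
        ... | inj₂ w∈R′ = disjoint (R⊆ w∈R , rs′⊆after w∈R′)
        ... | inj₁ w∈O with oldAtEnds (∈-++⁺ˡ (R⊆ w∈R)) (Old.PathIn⇒V Vs O (there w∈O))
        ...   | inj₁ refl = Unique[x∷xs]⇒x∉xs (proj₂ O) w∈O
        ...   | inj₂ refl = e∉before (R⊆ w∈R)
        avoids : x ∉ a ∷ rs ++ (os ++ rs′)
        avoids x∈ with ∈-++⁻ (a ∷ rs) x∈
        ... | inj₁ x∈R = a≢x (sym (beforeMeetsAfter (R⊆ x∈R) (∈-++⁺ˡ x∈mid)))
        avoids x∈ | inj₂ x∈OR′ with ∈-++⁻ os x∈OR′
        ... | inj₁ x∈O = x∉O (there x∈O)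
        ... | inj₂ x∈R′ with R′⊆ (there x∈R′)
        ...   | here refl     = b≢x refl
        ...   | there x∈rest  = disjAB (x∈mid , x∈rest)

    resplitBefore : ∀ {a b} (split : EarSplit a) → b ∈ s ∷ EarSplit.before split → b ≢ a →
      ∃ λ (split′ : EarSplit b) → a ∈ EarSplit.after split′
    resplitBefore {a} {b} split b∈ b≢a with splitPath toA b∈
      where open EarSplit split
    ... | us , us′ , refl , S→B , B→A , disjSB = record
      { before    = us
      ; after     = us′ ++ after
      ; oldAtEnds = λ {w} w∈ → oldAtEnds (subst (λ l → w ∈ s ∷ l) (sym (++-assoc us us′ after)) w∈)
      ; toA       = S→B
      ; fromA     = joinPath B→A fromA disjBA
      ; disjoint  = disj
      ; covers    = λ {w} w∈ → subst (λ l → w ∈ s ∷ l) (++-assoc us us′ after) (covers w∈)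
      } , a∈after
      where
      open EarSplit split
      disjBA : Disjoint (b ∷ us′) after
      disjBA (here refl , w∈A)  = disjoint (∈-++⁺ˡ (target∈ (proj₁ S→B)) , w∈A)
      disjBA (there w∈ , w∈A)   = disjoint (there (∈-++⁺ʳ us w∈) , w∈A)
      disj : Disjoint (s ∷ us) (us′ ++ after)
      disj (w∈S , w∈rest) with ∈-++⁻ us′ w∈rest
      ... | inj₁ w∈us′ = disjSB (w∈S , w∈us′)
      ... | inj₂ w∈A   = disjoint (∈-++⁺ˡ w∈S , w∈A)
      a∈after : a ∈ us′ ++ after
      a∈after with target∈ (proj₁ B→A)
      ... | here a≡b  = ⊥-elim (b≢a (sym a≡b))
      ... | there a∈  = ∈-++⁺ˡ a∈

    innerToInner : ∀ {a b x} → a ∈ ws → b ∈ ws → ¬ V a → ¬ V b → a ≢ b → a ≢ x → b ≢ x → Avoiding x a b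
    innerToInner a∈ b∈ ¬Va ¬Vb a≢b a≢x b≢x with splitEar a∈
    ... | split with ∈-++⁻ (s ∷ EarSplit.before split) (EarSplit.covers split b∈)
    ... | inj₂ b∈after  = innerToLater split ¬Va ¬Vb b∈after a≢x b≢x
    ... | inj₁ b∈before with resplitBefore split b∈before (λ b≡a → a≢b (sym b≡a))
    ...   | split′ , a∈after = reverseAvoiding (innerToLater split′ ¬Vb ¬Va a∈after b≢x a≢x)

    noCut⁺ : New.NoCutVertex
    noCut⁺ x a b V⁺a V⁺b a≢x b≢x with old⊎inner V⁺a | old⊎inner V⁺b
    ... | inj₁ Va | inj₁ Vb with noCut x a b Va Vb a≢x b≢x
    ...   | os , O , x∉O = os , lift O , x∉O
    noCut⁺ x a b _ _ a≢x b≢x | inj₁ Va | inj₂ (b∈ , ¬Vb) =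
      reverseAvoiding (innerToOld (splitEar b∈) ¬Vb Va b≢x a≢x)
    noCut⁺ x a b _ _ a≢x b≢x | inj₂ (a∈ , ¬Va) | inj₁ Vb = innerToOld (splitEar a∈) ¬Va Vb a≢x b≢x
    noCut⁺ x a b _ _ a≢x b≢x | inj₂ (a∈ , ¬Va) | inj₂ (b∈ , ¬Vb) with a ≟ b
    ... | yes refl = [] , ([] , Unique-∷⁺ (λ ()) []) , λ { (here x≡a) → a≢x (sym x≡a) }
    ... | no a≢b   = innerToInner a∈ b∈ ¬Va ¬Vb a≢b a≢x b≢x

module _ {A : Set} {a b : A} where

  ≢both⊎≡either : ∀ {c} → Dec (c ≡ a) → Dec (c ≡ b) → (c ≢ a × c ≢ b) ⊎ (c ≡ a ⊎ c ≡ b)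
  ≢both⊎≡either (yes c≡a) _         = inj₂ (inj₁ c≡a)
  ≢both⊎≡either (no c≢a)  (yes c≡b) = inj₂ (inj₂ c≡b)
  ≢both⊎≡either (no c≢a)  (no c≢b)  = inj₁ (c≢a , c≢b)

  thirdOfThree≢ : ∀ {c₀ c₁ c₂} → c₀ ≢ c₁ → c₀ ≢ c₂ → c₁ ≢ c₂ →
    c₀ ≡ a ⊎ c₀ ≡ b → c₁ ≡ a ⊎ c₁ ≡ b → c₂ ≢ a
  thirdOfThree≢ _     c₀≢c₂ _     (inj₁ c₀≡a) _           refl = c₀≢c₂ c₀≡a
  thirdOfThree≢ _     _     c₁≢c₂ (inj₂ _)    (inj₁ c₁≡a) refl = c₁≢c₂ c₁≡a
  thirdOfThree≢ c₀≢c₁ _     _     (inj₂ c₀≡b) (inj₂ c₁≡b) refl = c₀≢c₁ (trans c₀≡b (sym c₁≡b))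

avoidTwo : ∀ {A : Set} {c₀ c₁ c₂ : A} (a b : A) → (∀ x y → Dec (x ≡ y)) →
  c₀ ≢ c₁ → c₀ ≢ c₂ → c₁ ≢ c₂ → ∃ λ w → (w ≡ c₀ ⊎ w ≡ c₁ ⊎ w ≡ c₂) × w ≢ a × w ≢ b
avoidTwo {c₀ = c₀} {c₁} {c₂} a b _≟′_ c₀≢c₁ c₀≢c₂ c₁≢c₂ with ≢both⊎≡either (c₀ ≟′ a) (c₀ ≟′ b)
... | inj₁ (c₀≢a , c₀≢b) = c₀ , inj₁ refl , c₀≢a , c₀≢b
... | inj₂ c₀∈ with ≢both⊎≡either (c₁ ≟′ a) (c₁ ≟′ b)
...   | inj₁ (c₁≢a , c₁≢b) = c₁ , inj₂ (inj₁ refl) , c₁≢a , c₁≢b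
...   | inj₂ c₁∈ = c₂ , inj₂ (inj₂ refl) ,
          thirdOfThree≢ c₀≢c₁ c₀≢c₂ c₁≢c₂ c₀∈ c₁∈ , thirdOfThree≢ c₀≢c₁ c₀≢c₂ c₁≢c₂ (swap c₀∈) (swap c₁∈)

last-∷ʳ : ∀ {A : Set} (a : A) xs e → last (a ∷ xs ++ [ e ]) ≡ just e
last-∷ʳ a []       e = refl
last-∷ʳ a (x ∷ xs) e = last-∷ʳ x xs e

module _ {n : ℕ} (G : Graph n) where
  open Induced G

  NoCutVertex-resp : ∀ {V V′ : Fin n → Set} → (∀ {x} → V′ x → V x) → (∀ {x} → V x → V′ x) →
    NoCutVertex V → NoCutVertex V′
  NoCutVertex-resp to from noCut x a b V′a V′b a≢x b≢x with noCut x a b (to V′a) (to V′b) a≢x b≢x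
  ... | xs , (w , u) , x∉ = xs , (Walk-map (λ { (ab , Va , Vb) → ab , from Va , from Vb }) w , u) , x∉

  Walk-restrict : ∀ {V : Fin n → Set} {a b xs} → Walk (Adj G) a xs b → (∀ {w} → w ∈ a ∷ xs → V w) →
    Walk (AdjIn V) a xs b
  Walk-restrict []       _  = []
  Walk-restrict (ab ∷ w) in-V = (ab , in-V (here refl) , in-V (there (here refl))) ∷ Walk-restrict w (λ w∈ → in-V (there w∈))

  Endpoint : Fin n → Fin n → Fin n → Set
  Endpoint c d x = x ≡ c ⊎ x ≡ d

  edge-noCut : ∀ {c d} → Adj G c d → NoCutVertex (Endpoint c d)
  edge-noCut {c} {d} cd x a b Va Vb a≢x b≢x with a ≟ b
  ... | yes refl = [] , ([] , Unique-∷⁺ (λ ()) []) , λ { (here x≡a) → a≢x (sym x≡a) }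
  ... | no a≢b   = [ b ] , ((endpointsAdj Va Vb a≢b , Va , Vb) ∷ [] , Unique-∷⁺ (λ { (here a≡b) → a≢b a≡b }) (Unique-∷⁺ (λ ()) [])) ,
                   λ { (here x≡a) → a≢x (sym x≡a) ; (there (here x≡b)) → b≢x (sym x≡b) }
    where
    endpointsAdj : ∀ {a b} → Endpoint c d a → Endpoint c d b → a ≢ b → Adj G a b
    endpointsAdj (inj₁ refl) (inj₁ refl) a≢b = ⊥-elim (a≢b refl)
    endpointsAdj (inj₁ refl) (inj₂ refl) _   = cd
    endpointsAdj (inj₂ refl) (inj₁ refl) _   = Adj-sym G cd
    endpointsAdj (inj₂ refl) (inj₂ refl) a≢b = ⊥-elim (a≢b refl)

  addEar-noCut : ∀ {V : Fin n → Set} → NoCutVertex V → ∀ s e inner →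
    Linked (Adj G) (s ∷ inner ++ [ e ]) → Unique (s ∷ inner ++ [ e ]) → V s → V e →
    (∀ {w} → w ∈ inner → ¬ V w) → NoCutVertex (λ x → V x ⊎ x ∈ s ∷ inner ++ [ e ])
  addEar-noCut {V} noCut s e inner linked u Vs Ve innerNew =
    AddEar.noCut⁺ G V s e inner noCut
      (Walk-restrict (Linked⇒Walk (inner ++ [ e ]) linked (last-∷ʳ s inner e)) inj₂ , u) Vs Ve innerNew

  -- a cycle is an ear attached to one of its edges
  cycle-noCut : ∀ cs → IsCycle G cs → NoCutVertex (_∈ cs)
  cycle-noCut (c ∷ cs) (3≤ , linked , u , _ , b , refl , end , bc)
    with []⊎∷ʳ (Linked⇒Walk cs linked end)
  ... | inj₁ refl with 3≤
  ...   | s≤s ()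
  cycle-noCut (c ∷ _) (_ , linked , u , _ , b , refl , _ , bc) | inj₂ (inner , refl) =
    NoCutVertex-resp inj₂ onCycle
      (addEar-noCut (edge-noCut (Adj-sym G bc)) c b inner linked u (inj₁ refl) (inj₂ refl) innerNew)
    where
    innerNew : ∀ {w} → w ∈ inner → ¬ Endpoint c b w
    innerNew w∈ (inj₁ refl) = Unique[x∷xs]⇒x∉xs u (∈-++⁺ˡ w∈)
    innerNew w∈ (inj₂ refl) = Unique-++⇒Disjoint inner (Unique-∷⁻ u) (w∈ , here refl)
    onCycle : ∀ {x} → Endpoint c b x ⊎ x ∈ c ∷ inner ++ [ b ] → x ∈ c ∷ inner ++ [ b ]
    onCycle (inj₁ (inj₁ refl)) = here refl
    onCycle (inj₁ (inj₂ refl)) = there (∈-++⁺ʳ inner (here refl))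
    onCycle (inj₂ x∈)          = x∈

  cycle-third : ∀ cs → IsCycle G cs → ∀ a b → ∃ λ w → w ∈ cs × w ≢ a × w ≢ b
  cycle-third (c₀ ∷ c₁ ∷ c₂ ∷ cs) (_ , _ , u , _) a b
    with avoidTwo a b _≟_ (λ c₀≡c₁ → Unique[x∷xs]⇒x∉xs u (here c₀≡c₁))
                          (λ c₀≡c₂ → Unique[x∷xs]⇒x∉xs u (there (here c₀≡c₂)))
                          (λ c₁≡c₂ → Unique[x∷xs]⇒x∉xs (Unique-∷⁻ u) (here c₁≡c₂))
  ... | w , inj₁ refl          , w≢a , w≢b = w , here refl , w≢a , w≢b
  ... | w , inj₂ (inj₁ refl)   , w≢a , w≢b = w , there (here refl) , w≢a , w≢b
  ... | w , inj₂ (inj₂ refl)   , w≢a , w≢b = w , there (there (here refl)) , w≢a , w≢b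
  cycle-third (_ ∷ [])     (s≤s () , _)
  cycle-third (_ ∷ _ ∷ []) (s≤s (s≤s ()) , _)

module Prefixes {n : ℕ} (G : Graph n) (D : EarDecomposition G) where
  open EarDecomposition D hiding (V)
  open Induced G

  Built : ℕ → Fin n → Set
  Built l x = ∃ λ (j : Fin (suc t)) → toℕ j ≤ l × x ∈ DecV P₀ ear j

  built-noCut : ∀ l → l ≤ t → NoCutVertex (Built l)
  built-noCut zero _ = NoCutVertex-resp G inP₀ (λ x∈ → Fin.zero , z≤n , x∈) (cycle-noCut G P₀ cycle)
    where
    inP₀ : ∀ {x} → Built 0 x → x ∈ P₀
    inP₀ (Fin.zero , _ , x∈) = x∈
  built-noCut (suc l) l<t =
    NoCutVertex-resp G split join
      (addEar-noCut G (built-noCut l (<⇒≤ l<t)) (s (ear i)) (e (ear i)) (inner (ear i))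
        (proj₁ (earPath i)) (proj₂ (earPath i))
        (fromPrev (proj₁ (earEnds i))) (fromPrev (proj₂ (earEnds i)))
        (λ x∈ Bx → earInner i _ x∈ (toPrev Bx)))
    where
    i : Fin t
    i = fromℕ< l<t
    toℕi≡l : toℕ i ≡ l
    toℕi≡l = toℕ-fromℕ< l<t
    fromPrev : ∀ {x} → PrevV P₀ ear i x → Built l x
    fromPrev (j , j≤i , x∈) = j , subst (toℕ j ≤_) toℕi≡l j≤i , x∈
    toPrev : ∀ {x} → Built l x → PrevV P₀ ear i x
    toPrev (j , j≤l , x∈) = j , subst (toℕ j ≤_) (sym toℕi≡l) j≤l , x∈
    split : ∀ {x} → Built (suc l) x → Built l x ⊎ x ∈ earVerts (ear i)
    split (j , j≤1+l , x∈) with toℕ j ≤? l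
    ... | yes j≤l = inj₁ (j , j≤l , x∈)
    split (Fin.zero  , _ , x∈)     | no j≰l = ⊥-elim (j≰l z≤n)
    split (Fin.suc j , s≤s j≤l , x∈) | no j≰l
      with toℕ-injective (trans (≤-antisym j≤l (≤-pred (≰⇒> j≰l))) (sym toℕi≡l))
    ... | refl = inj₂ x∈
    join : ∀ {x} → Built l x ⊎ x ∈ earVerts (ear i) → Built (suc l) x
    join (inj₁ (j , j≤l , x∈)) = j , ≤-trans j≤l (n≤1+n l) , x∈
    join (inj₂ x∈)             = Fin.suc i , s≤s (≤-reflexive toℕi≡l) , x∈

  prev-noCut : ∀ i → NoCutVertex (PrevV P₀ ear i)
  prev-noCut i = built-noCut (toℕ i) (<⇒≤ (toℕ<n i))

  prev-third : ∀ i → ThirdVertex (PrevV P₀ ear i)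
  prev-third i a b with cycle-third G P₀ cycle a b
  ... | w , w∈ , w≢a , w≢b = w , (Fin.zero , z≤n , w∈) , w≢a , w≢b

-- The graph with the attached ear
∨≡true⁻ : ∀ a b → a ∨ b ≡ true → a ≡ true ⊎ b ≡ true
∨≡true⁻ true  _ _  = inj₁ refl
∨≡true⁻ false _ ab = inj₂ ab

∧≡true⁻ : ∀ a b → a ∧ b ≡ true → a ≡ true × b ≡ true
∧≡true⁻ true true _ = refl , refl

∨≡true⁺ˡ : ∀ {a} b → a ≡ true → a ∨ b ≡ true
∨≡true⁺ˡ _ refl = refl

∨≡true⁺ʳ : ∀ a {b} → b ≡ true → a ∨ b ≡ true
∨≡true⁺ʳ true  _  = refl
∨≡true⁺ʳ false bt = bt

∧≡true⁺ : ∀ {a b} → a ≡ true → b ≡ true → a ∧ b ≡ true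
∧≡true⁺ refl refl = refl

≡ᵇ⇒≡′ : ∀ m n → (m ≡ᵇ n) ≡ true → m ≡ n
≡ᵇ⇒≡′ zero    zero    _ = refl
≡ᵇ⇒≡′ (suc m) (suc n) p = cong suc (≡ᵇ⇒≡′ m n p)

≡ᵇ-refl : ∀ m → (m ≡ᵇ m) ≡ true
≡ᵇ-refl zero    = refl
≡ᵇ-refl (suc m) = ≡ᵇ-refl m

module _ {n : ℕ} where

  eqᵇ⇒≡ : ∀ (a b : Fin n) → eqᵇ a b ≡ true → a ≡ b
  eqᵇ⇒≡ a b p with a ≟ b
  ... | yes a≡b = a≡b

  eqᵇ-refl : ∀ (a : Fin n) → eqᵇ a a ≡ true
  eqᵇ-refl a with a ≟ a
  ... | yes _  = refl
  ... | no a≢a = ⊥-elim (a≢a refl)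

module Attached {n : ℕ} (G : Graph n) (u v : Fin n) (u≢v : u ≢ v) (r : ℕ) where

  H : Graph (n + r)
  H = attachEar G u v u≢v r

  old : Fin n → Fin (n + r)
  old x = x ↑ˡ r

  new : Fin r → Fin (n + r)
  new j = n ↑ʳ j

  old-adj : ∀ {a b} → Adj G a b → Adj H (old a) (old b)
  old-adj {a} {b} ab rewrite splitAt-↑ˡ n a r | splitAt-↑ˡ n b r | ab = refl

  new-adj-v : ∀ j → suc (toℕ j) ≡ r → Adj H (new j) (old v)
  new-adj-v j 1+j≡r rewrite splitAt-↑ʳ n r j | splitAt-↑ˡ n v r =
    ∨≡true⁺ʳ _ (∧≡true⁺ (eqᵇ-refl v) (trans (cong (_≡ᵇ r) 1+j≡r) (≡ᵇ-refl r)))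

  new-adj-new : ∀ j j′ → toℕ j′ ≡ suc (toℕ j) → Adj H (new j) (new j′)
  new-adj-new j j′ j′≡1+j rewrite splitAt-↑ʳ n r j | splitAt-↑ʳ n r j′ =
    ∨≡true⁺ˡ _ (trans (cong (suc (toℕ j) ≡ᵇ_) j′≡1+j) (≡ᵇ-refl (suc (toℕ j))))

  u-adj-new : ∀ j → toℕ j ≡ 0 → Adj H (old u) (new j)
  u-adj-new j j≡0 rewrite splitAt-↑ˡ n u r | splitAt-↑ʳ n r j =
    ∨≡true⁺ˡ _ (∧≡true⁺ (eqᵇ-refl u) (cong (_≡ᵇ 0) j≡0))

  u-adj-v : r ≡ 0 → Adj H (old u) (old v)
  u-adj-v r≡0 rewrite splitAt-↑ˡ n u r | splitAt-↑ˡ n v r =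
    ∨≡true⁺ʳ _ (∧≡true⁺ (cong (_≡ᵇ 0) r≡0) (∨≡true⁺ˡ _ (∧≡true⁺ (eqᵇ-refl u) (eqᵇ-refl v))))

  new≢old : ∀ j a → new j ≢ old a
  new≢old j a eq with trans (sym (splitAt-↑ʳ n r j)) (trans (cong (splitAt n) eq) (splitAt-↑ˡ n a r))
  ... | ()

  old-u≢old-v : old u ≢ old v
  old-u≢old-v eq = u≢v (↑ˡ-injective r u v eq)

  private
    j<r : ∀ j d → j + suc d ≡ r → j < r
    j<r j d eq = subst (j <_) eq (m<m+n j (s≤s z≤n))

    shift : ∀ j d → j + suc d ≡ r → suc j + d ≡ r
    shift j d eq = trans (sym (+-suc j d)) eq

  newFrom : (j d : ℕ) → j + d ≡ r → List (Fin (n + r))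
  newFrom j zero    _  = []
  newFrom j (suc d) eq = new (fromℕ< (j<r j d eq)) ∷ newFrom (suc j) d (shift j d eq)

  firstOf : (j d : ℕ) → j + d ≡ r → Fin (n + r)
  firstOf j zero    _  = old v
  firstOf j (suc d) eq = new (fromℕ< (j<r j d eq))

  newFrom-walk : ∀ j d (eq : j + d ≡ r) p → Adj H p (firstOf j d eq) →
    Walk (Adj H) p (newFrom j d eq ++ [ old v ]) (old v)
  newFrom-walk j zero    eq p pf = pf ∷ []
  newFrom-walk j (suc d) eq p pf = pf ∷ newFrom-walk (suc j) d (shift j d eq) _ (next d (shift j d eq))
    where
    J : Fin r
    J = fromℕ< (j<r j d eq)
    toℕJ≡j : toℕ J ≡ j
    toℕJ≡j = toℕ-fromℕ< (j<r j d eq)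
    next : ∀ d′ (eq′ : suc j + d′ ≡ r) → Adj H (new J) (firstOf (suc j) d′ eq′)
    next zero     eq′ = new-adj-v J (trans (cong suc toℕJ≡j) (trans (sym (+-identityʳ (suc j))) eq′))
    next (suc d′) eq′ = new-adj-new J _ (trans (toℕ-fromℕ< (j<r (suc j) d′ eq′)) (cong suc (sym toℕJ≡j)))

  newFrom-new : ∀ j d eq {x} → x ∈ newFrom j d eq → ∃ λ J → x ≡ new J × j ≤ toℕ J
  newFrom-new j (suc d) eq (here refl) = _ , refl , ≤-reflexive (sym (toℕ-fromℕ< (j<r j d eq)))
  newFrom-new j (suc d) eq (there x∈) with newFrom-new (suc j) d (shift j d eq) x∈
  ... | J , refl , j<J = J , refl , ≤-trans (n≤1+n j) j<J

  length-newFrom : ∀ j d eq → length (newFrom j d eq) ≡ d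
  length-newFrom j zero    eq = refl
  length-newFrom j (suc d) eq = cong suc (length-newFrom (suc j) d (shift j d eq))

  newFrom-unique : ∀ j d eq → Unique (newFrom j d eq)
  newFrom-unique j zero    eq = []
  newFrom-unique j (suc d) eq = Unique-∷⁺ first∉ (newFrom-unique (suc j) d (shift j d eq))
    where
    first∉ : new (fromℕ< (j<r j d eq)) ∉ newFrom (suc j) d (shift j d eq)
    first∉ x∈ with newFrom-new (suc j) d (shift j d eq) x∈
    ... | J , eqJ , j<J with ↑ʳ-injective n _ _ eqJ
    ... | refl = <-irrefl (sym (toℕ-fromℕ< (j<r j d eq))) j<J

  earTail : List (Fin (n + r))
  earTail = newFrom 0 r refl ++ [ old v ]

  length-earTail : length earTail ≡ r + 1
  length-earTail = trans (length-++ (newFrom 0 r refl)) (cong (_+ 1) (length-newFrom 0 r refl))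

  earPath : SimplePath (Adj H) (old u) earTail (old v)
  earPath = newFrom-walk 0 r refl (old u) (firstAdj r refl) ,
            Unique-∷⁺ u∉ (Unique.++⁺ (newFrom-unique 0 r refl) (Unique-∷⁺ (λ ()) []) v∉)
    where
    firstAdj : ∀ d (eq : 0 + d ≡ r) → Adj H (old u) (firstOf 0 d eq)
    firstAdj zero    eq = u-adj-v (sym eq)
    firstAdj (suc d) eq = u-adj-new _ (toℕ-fromℕ< (j<r 0 d eq))
    v∉ : ∀ {x} → ¬ (x ∈ newFrom 0 r refl × x ∈ [ old v ])
    v∉ (x∈ , here refl) with newFrom-new 0 r refl x∈
    ... | J , eq , _ = new≢old J v (sym eq)
    u∉ : old u ∉ earTail
    u∉ u∈ with ∈-++⁻ (newFrom 0 r refl) u∈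
    ... | inj₁ u∈new with newFrom-new 0 r refl u∈new
    ...   | J , eq , _ = new≢old J u (sym eq)
    u∉ _ | inj₂ (here eq) = old-u≢old-v eq

  IsOld : Fin (n + r) → Set
  IsOld z = ∃ λ a → splitAt n z ≡ inj₁ a

  private
    EA : Fin n ⊎ Fin r → Fin n ⊎ Fin r → Bool
    EA = earAdj G u v u≢v r

    adj-at : ∀ {y sy sz} → splitAt n y ≡ sy → EA (splitAt n y) sz ≡ true → EA sy sz ≡ true
    adj-at refl yz = yz

  -- A path entering the ear at w_j, that has not visited w₀, …, w_{j-1} and avoids u,
  -- must run along the ear to v.
  alongEar : ∀ j xs {y J} → splitAt n y ≡ inj₂ J → toℕ J ≡ j → Walk (Adj H) y xs (old v) →
    Unique (y ∷ xs) → (∀ J′ → toℕ J′ < j → new J′ ∉ xs) → old u ∉ xs → length xs + j ≡ r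
  alongEar j [] ey _ [] _ _ _ with trans (sym ey) (splitAt-↑ˡ n v r)
  ... | ()
  alongEar j (z ∷ xs) {y} {J} ey J≡j (yz ∷ w) U earlier∉ u∉ with splitAt n z in ez
  ... | inj₁ a with ∨≡true⁻ _ _ (adj-at ey yz)
  ...   | inj₁ p with eqᵇ⇒≡ a u (proj₁ (∧≡true⁻ _ _ p))
  ...     | refl = ⊥-elim (u∉ (here (splitAt⁻¹-↑ˡ ez)))
  alongEar j (z ∷ xs) {y} {J} ey J≡j (yz ∷ w) U earlier∉ u∉ | inj₁ a | inj₂ p
    with ∧≡true⁻ _ _ p
  ... | a≡v , 1+J≡r with eqᵇ⇒≡ a v a≡v | splitAt⁻¹-↑ˡ ez
  ...   | refl | refl with closedPath⇒[] (w , Unique-∷⁻ U)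
  ...     | refl = trans (cong suc (sym J≡j)) (≡ᵇ⇒≡′ _ _ 1+J≡r)
  alongEar j (z ∷ xs) {y} {J} ey J≡j (yz ∷ w) U earlier∉ u∉ | inj₂ J′ with ∨≡true⁻ _ _ (adj-at ey yz)
  ... | inj₁ p = trans (sym (+-suc (length xs) j))
                   (alongEar (suc j) xs ez (trans (sym (≡ᵇ⇒≡′ _ _ p)) (cong suc J≡j)) w (Unique-∷⁻ U)
                     earlier∉′ (λ u∈ → u∉ (there u∈)))
    where
    earlier∉′ : ∀ J″ → toℕ J″ < suc j → new J″ ∉ xs
    earlier∉′ J″ J″<1+j J″∈ with m<1+n⇒m<n∨m≡n J″<1+j
    ... | inj₁ J″<j = earlier∉ J″ J″<j (there J″∈)
    ... | inj₂ J″≡j with toℕ-injective (trans J″≡j (sym J≡j))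
    ...   | refl = Unique[x∷xs]⇒x∉xs U (there (subst (_∈ xs) (splitAt⁻¹-↑ʳ ey) J″∈))
  ... | inj₂ p = ⊥-elim (earlier∉ J′ (subst (suc (toℕ J′) ≤_) J≡j (≤-reflexive (≡ᵇ⇒≡′ _ _ p)))
                           (here (splitAt⁻¹-↑ʳ ez)))

  avoiding-u⇒old : ∀ xs {y c} → splitAt n y ≡ inj₁ c → y ≢ old u → Walk (Adj H) y xs (old v) →
    Unique (y ∷ xs) → old u ∉ xs → ∀ {z} → z ∈ xs → IsOld z
  avoiding-u⇒old (z ∷ xs) {y} {c} ey y≢u (yz ∷ w) U u∉ z∈ with splitAt n z in ez
  ... | inj₂ J with ∨≡true⁻ _ _ (adj-at ey yz)
  ...   | inj₁ p with eqᵇ⇒≡ c u (proj₁ (∧≡true⁻ _ _ p))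
  ...     | refl = ⊥-elim (y≢u (sym (splitAt⁻¹-↑ˡ ey)))
  avoiding-u⇒old (z ∷ xs) {y} {c} ey y≢u (yz ∷ w) U u∉ z∈ | inj₂ J | inj₂ p
    with eqᵇ⇒≡ c v (proj₁ (∧≡true⁻ _ _ p))
  ... | refl with splitAt⁻¹-↑ˡ ey
  ...   | refl = ⊥-elim (Unique[x∷xs]⇒x∉xs U (target∈ w))
  avoiding-u⇒old (z ∷ xs) ey y≢u (yz ∷ w) U u∉ (here refl) | inj₁ a = a , ez
  avoiding-u⇒old (z ∷ xs) ey y≢u (yz ∷ w) U u∉ (there z∈) | inj₁ a =
    avoiding-u⇒old xs ez (λ z≡u → u∉ (here (sym z≡u))) w (Unique-∷⁻ U) (λ u∈ → u∉ (there u∈)) z∈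

  ear⊎old : ∀ {xs} → SimplePath (Adj H) (old u) xs (old v) → length xs ≡ r + 1 ⊎ (∀ {z} → z ∈ xs → IsOld z)
  ear⊎old {[]} (w , _) = ⊥-elim (old-u≢old-v (closedWalk w))
    where
    closedWalk : ∀ {a b} → Walk (Adj H) a [] b → a ≡ b
    closedWalk [] = refl
  ear⊎old {y ∷ xs} (uy ∷ w , U) with splitAt n y in ey
  ... | inj₂ J with ∨≡true⁻ _ _ (adj-at (splitAt-↑ˡ n u r) uy)
  ...   | inj₁ p = inj₁ (begin
          suc (length xs)     ≡⟨ cong suc (sym (+-identityʳ (length xs))) ⟩
          suc (length xs + 0) ≡⟨ cong suc (alongEar 0 xs ey (≡ᵇ⇒≡′ _ _ (proj₂ (∧≡true⁻ _ _ p))) w (Unique-∷⁻ U)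
                                             (λ _ ()) (λ u∈ → Unique[x∷xs]⇒x∉xs U (there u∈))) ⟩
          suc r               ≡⟨ +-comm 1 r ⟩
          r + 1               ∎)
    where open ≡-Reasoning
  ...   | inj₂ p = ⊥-elim (u≢v (eqᵇ⇒≡ u v (proj₁ (∧≡true⁻ _ _ p))))
  ear⊎old {y ∷ xs} (uy ∷ w , U) | inj₁ c = inj₂ λ
    { (here refl) → c , ey
    ; (there z∈)  → avoiding-u⇒old xs ey (λ y≡u → Unique[x∷xs]⇒x∉xs U (here (sym y≡u))) w (Unique-∷⁻ U)
                      (λ u∈ → Unique[x∷xs]⇒x∉xs U (there u∈)) z∈ }

  old-meets-ear-at-v : ∀ {xs} → (∀ {z} → z ∈ xs → IsOld z) → MeetOnlyAt (old v) xs earTail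
  old-meets-ear-at-v allOld z∈ z∈ear with ∈-++⁻ (newFrom 0 r refl) z∈ear
  ... | inj₂ (here refl) = refl
  ... | inj₁ z∈new with newFrom-new 0 r refl z∈new | allOld z∈
  ...   | J , refl , _ | a , eq with trans (sym (splitAt-↑ʳ n r J)) eq
  ...     | ()

  liftPath : ∀ {a b xs} → SimplePath (Adj G) a xs b → SimplePath (Adj H) (old a) (map old xs) (old b)
  liftPath (w , U) = liftWalk w , Unique.map⁺ (↑ˡ-injective r _ _) U
    where
    liftWalk : ∀ {a b xs} → Walk (Adj G) a xs b → Walk (Adj H) (old a) (map old xs) (old b)
    liftWalk []       = []
    liftWalk (ab ∷ w) = old-adj ab ∷ liftWalk w

  lifted-old : ∀ {xs z} → z ∈ map old xs → IsOld z
  lifted-old z∈ with ∈-map⁻ old z∈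
  ... | y , _ , refl = y , splitAt-↑ˡ n y r

-- when r = 0 the ear is the single edge uv, so a u–v path of length 1 gives no cycle with it
short⊎cycle : ∀ x r → 1 ≤ x → 3 ≤ x + (r + 1) ⊎ (x ≡ 1 × r ≡ 0)
short⊎cycle (suc zero)    zero    _ = inj₂ (refl , refl)
short⊎cycle (suc (suc x)) zero    _ = inj₁ (subst (3 ≤_) (sym (+-comm (suc (suc x)) 1)) (s≤s (s≤s (s≤s z≤n))))
short⊎cycle (suc x)       (suc r) _ =
  inj₁ (subst (3 ≤_) (sym (+-comm (suc x) (suc r + 1)))
    (s≤s (subst (2 ≤_) (sym (+-assoc r 1 (suc x))) (≤-trans (s≤s (s≤s z≤n)) (m≤n+m (suc (1 + x)) r)))))

module EarLength {n : ℕ} (G : Graph n) (u v : Fin n) (u≢v : u ≢ v) (r : ℕ)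
  {k m k′ : ℕ} (2∤m : ¬ 2 ∣ m) (2k′≡k : 2 * k′ ≡ₘ k [mod m ]) where
  open Attached G u v u≢v r
  open HalfModulus {k′ = k′} 2∤m 2k′≡k

  module _ (cyclesH : AllCyclesMod H k m) where

    closesWithEar : ∀ {xs} → SimplePath (Adj H) (old u) xs (old v) → (∀ {z} → z ∈ xs → IsOld z) →
      3 ≤ length xs + (r + 1) → length xs + (r + 1) ≡ₘ k [mod m ]
    closesWithEar {xs} P allOld 3≤ =
      subst (λ l → length xs + l ≡ₘ k [mod m ]) length-earTail
        (meetOnlyAt-≡ₘk H cyclesH old-u≢old-v P earPath (old-meets-ear-at-v allOld)
          (subst (λ l → 3 ≤ length xs + l) (sym length-earTail) 3≤))

    module _ (noEdge : r ≡ 0 → adj G u v ≡ false) where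

      pathInG-closesWithEar : ∀ {xs} → SimplePath (Adj G) u xs v → length xs + (r + 1) ≡ₘ k [mod m ]
      pathInG-closesWithEar {xs} P with short⊎cycle (length xs) r (≢⇒1≤length (proj₁ P) u≢v)
      ... | inj₁ 3≤ = subst (λ l → l + (r + 1) ≡ₘ k [mod m ]) (length-map old xs)
                        (closesWithEar (liftPath P) lifted-old (subst (λ l → 3 ≤ l + (r + 1)) (sym (length-map old xs)) 3≤))
      ... | inj₂ (length≡1 , r≡0) with P
      ...   | uv ∷ [] , _ with trans (sym uv) (noEdge r≡0)
      ...     | ()

      ear-≡ₘk′ : AllCyclesMod G k m → ∀ {xs ys} → SimplePath (Adj G) u xs v → SimplePath (Adj G) u ys v →
        MeetOnlyAt v xs ys → 3 ≤ length xs + length ys → r + 1 ≡ₘ k′ [mod m ]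
      ear-≡ₘk′ cyclesG {xs} {ys} A B meet 3≤ =
        theta-≡ₘk′ {a = length xs} {b = length ys} (pathInG-closesWithEar A) (pathInG-closesWithEar B) (meetOnlyAt-≡ₘk G cyclesG u≢v A B meet 3≤)

    uvPath-≡ₘk′ : r + 1 ≡ₘ k′ [mod m ] → (p : Path H (old u) (old v)) → pathLength p ≡ₘ k′ [mod m ]
    uvPath-≡ₘk′ ear≡k′ p with Path⇒SimplePath H p
    ... | xs , P , length≡ , _ with ear⊎old P
    ... | inj₁ onEar = ≡ₘ-trans (≡ₘ-reflexive (trans length≡ onEar)) ear≡k′
    ... | inj₂ allOld with short⊎cycle (length xs) r (≢⇒1≤length (proj₁ P) old-u≢old-v)
    ...   | inj₂ (length≡1 , refl) = ≡ₘ-trans (≡ₘ-reflexive (trans length≡ length≡1)) ear≡k′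
    ...   | inj₁ 3≤ = ≡ₘ-trans (≡ₘ-reflexive length≡) (complement-≡ₘk′ (closesWithEar P allOld 3≤) ear≡k′)

-- Crossed thetas
2≤+1≤⇒3≤ : ∀ {x y} → 2 ≤ x → 1 ≤ y → 3 ≤ x + y
2≤+1≤⇒3≤ {x} {suc y} 2≤x _ = subst (3 ≤_) (sym (+-suc x y)) (s≤s (≤-trans 2≤x (m≤m+n x y)))

module _ {n : ℕ} (G : Graph n) where

  record Cut (z₁ : Fin n) (xs : List (Fin n)) (z₂ a : Fin n) : Set where
    field
      front back : List (Fin n)
      split      : xs ≡ front ++ back
      toCut      : SimplePath (Adj G) z₁ front a
      fromCut    : SimplePath (Adj G) a back z₂
      front≥1    : 1 ≤ length front
      back≥1     : 1 ≤ length back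
      z₂∈back    : z₂ ∈ back
      z₂∉front   : z₂ ∉ z₁ ∷ front

    front⊆ : ∀ {w} → w ∈ front → w ∈ xs
    front⊆ {w} w∈ = subst (w ∈_) (sym split) (∈-++⁺ˡ w∈)

    back⊆ : ∀ {w} → w ∈ back → w ∈ xs
    back⊆ {w} w∈ = subst (w ∈_) (sym split) (∈-++⁺ʳ front w∈)

  cutAt : ∀ {z₁ z₂ a xs} → SimplePath (Adj G) z₁ xs z₂ → a ∈ xs → a ≢ z₂ → Cut z₁ xs z₂ a
  cutAt {z₁} {z₂} {a} P a∈ a≢z₂ with splitPath P (there a∈)
  ... | front , back , refl , F , B , disj = record
    { front    = front
    ; back     = back
    ; split    = refl
    ; toCut    = F
    ; fromCut  = B
    ; front≥1  = ≢⇒1≤length (proj₁ F) z₁≢a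
    ; back≥1   = ≢⇒1≤length (proj₁ B) a≢z₂
    ; z₂∈back  = z₂∈back
    ; z₂∉front = λ z₂∈ → disj (z₂∈ , z₂∈back)
    }
    where
    z₁≢a : z₁ ≢ a
    z₁≢a refl = Unique[x∷xs]⇒x∉xs (proj₂ P) a∈
    z₂∈back : z₂ ∈ back
    z₂∈back with target∈ (proj₁ B)
    ... | here z₂≡a = ⊥-elim (a≢z₂ (sym z₂≡a))
    ... | there z₂∈ = z₂∈

  Cut⇒2≤length : ∀ {z₁ xs z₂ a} → Cut z₁ xs z₂ a → 2 ≤ length xs
  Cut⇒2≤length c = subst (2 ≤_) (sym (trans (cong length split) (length-++ front)))
                     (+-mono-≤ front≥1 back≥1)
    where open Cut c

  record CrossedTheta (a b : Fin n) : Set where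
    field
      {z₁ z₂}    : Fin n
      {xs ys zs} : List (Fin n)
      z₁≢z₂      : z₁ ≢ z₂
      X          : SimplePath (Adj G) z₁ xs z₂
      Y          : SimplePath (Adj G) z₁ ys z₂
      Z          : SimplePath (Adj G) z₁ zs z₂
      mXY        : MeetOnlyAt z₂ xs ys
      mXZ        : MeetOnlyAt z₂ xs zs
      mYZ        : MeetOnlyAt z₂ ys zs
      a∈         : a ∈ xs
      a≢z₂       : a ≢ z₂
      b∈         : b ∈ ys
      b≢z₂       : b ≢ z₂

  module CrossingPaths {a b : Fin n} (θ : CrossedTheta a b) where
    open CrossedTheta θ
    module CX = Cut (cutAt X a∈ a≢z₂)
    module CY = Cut (cutAt Y b∈ b≢z₂)

    z₁∉xs : z₁ ∉ xs
    z₁∉xs = Unique[x∷xs]⇒x∉xs (proj₂ X)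
    z₁∉ys : z₁ ∉ ys
    z₁∉ys = Unique[x∷xs]⇒x∉xs (proj₂ Y)
    z₁∉zs : z₁ ∉ zs
    z₁∉zs = Unique[x∷xs]⇒x∉xs (proj₂ Z)
    module RX = Reversal (reversePath (Adj-sym G) CX.toCut)
    module RY = Reversal (reversePath (Adj-sym G) CY.fromCut)
    module RZ = Reversal (reversePath (Adj-sym G) Z)
    -- a → z₁ along X, z₁ → z₂ along Z, z₂ → b along Y
    viaZ : SimplePath (Adj G) a (RX.tail ++ (zs ++ RY.tail)) b
    viaZ = joinPath RX.path (joinPath Z RY.path disjZY) disjXZY
      where
      disjZY : Disjoint (z₁ ∷ zs) RY.tail
      disjZY (w∈Z , w∈RY) with RY.⊆forward (there w∈RY) | w∈Z
      ... | here refl    | here refl  = z₁∉ys b∈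
      ... | there w∈back | here refl  = z₁∉ys (CY.back⊆ w∈back)
      ... | here refl    | there w∈zs = b≢z₂ (mYZ b∈ w∈zs)
      ... | there w∈back | there w∈zs with mYZ (CY.back⊆ w∈back) w∈zs
      ...   | refl = Unique[x∷xs]⇒x∉xs (proj₂ RY.path) w∈RY
      disjXZY : Disjoint (a ∷ RX.tail) (zs ++ RY.tail)
      disjXZY (w∈RX , w∈ZY) with RX.⊆forward w∈RX | ∈-++⁻ zs w∈ZY
      ... | here refl     | inj₁ w∈zs = z₁∉zs w∈zs
      ... | there w∈front | inj₁ w∈zs with mXZ (CX.front⊆ w∈front) w∈zs
      ...   | refl = CX.z₂∉front (there w∈front)
      disjXZY (w∈RX , w∈ZY) | w∈front | inj₂ w∈RY with RY.⊆forward (there w∈RY) | w∈front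
      ... | here refl    | here refl      = z₁∉ys b∈
      ... | there w∈back | here refl      = z₁∉ys (CY.back⊆ w∈back)
      ... | w∈b∷back     | there w∈front′ with mXY (CX.front⊆ w∈front′) (inY w∈b∷back)
        where
        inY : ∀ {w} → w ∈ _ ∷ CY.back → w ∈ ys
        inY (here refl) = b∈
        inY (there w∈)  = CY.back⊆ w∈
      ...   | refl = CX.z₂∉front (there w∈front′)
    -- a → z₂ along X, z₂ → z₁ along Z, z₁ → b along Y
    viaZ⁻¹ : SimplePath (Adj G) a (CX.back ++ (RZ.tail ++ CY.front)) b
    viaZ⁻¹ = joinPath CX.fromCut (joinPath RZ.path CY.toCut disjZY) disjXZY
      where
      disjZY : Disjoint (z₂ ∷ RZ.tail) CY.front
      disjZY (w∈RZ , w∈front) with RZ.⊆forward w∈RZ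
      ... | here refl  = Unique[x∷xs]⇒x∉xs (proj₂ CY.toCut) w∈front
      ... | there w∈zs with mYZ (CY.front⊆ w∈front) w∈zs
      ...   | refl = CY.z₂∉front (there w∈front)
      inX : ∀ {w} → w ∈ a ∷ CX.back → w ∈ xs
      inX (here refl) = a∈
      inX (there w∈)  = CX.back⊆ w∈
      disjXZY : Disjoint (a ∷ CX.back) (RZ.tail ++ CY.front)
      disjXZY (w∈X , w∈ZY) with ∈-++⁻ RZ.tail w∈ZY
      ... | inj₁ w∈RZ with RZ.⊆forward (there w∈RZ)
      ...   | here refl = z₁∉xs (inX w∈X)
      ...   | there w∈zs with mXZ (inX w∈X) w∈zs
      ...     | refl = Unique[x∷xs]⇒x∉xs (proj₂ RZ.path) w∈RZ
      disjXZY (w∈X , w∈ZY) | inj₂ w∈front with mXY (inX w∈X) (CY.front⊆ w∈front)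
      ... | refl = CY.z₂∉front (there w∈front)
    length-viaZ : length CX.front + length zs + length CY.back ≡ length (RX.tail ++ (zs ++ RY.tail))
    length-viaZ rewrite length-++ RX.tail {zs ++ RY.tail} | length-++ zs {RY.tail} | RX.length≡ | RY.length≡ =
      +-assoc (length CX.front) (length zs) (length CY.back)
    length-viaZ⁻¹ : length CX.back + length zs + length CY.front ≡ length (CX.back ++ (RZ.tail ++ CY.front))
    length-viaZ⁻¹ rewrite length-++ CX.back {RZ.tail ++ CY.front} | length-++ RZ.tail {CY.front} | RZ.length≡ =
      +-assoc (length CX.back) (length zs) (length CY.front)

  module _ {k m k′ : ℕ} (cycles : AllCyclesMod G k m) (2∤m : ¬ 2 ∣ m) (2k′≡k : 2 * k′ ≡ₘ k [mod m ]) where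
    open HalfModulus {k′ = k′} 2∤m 2k′≡k

    crossedTheta-sides-≡ₘk′ : ∀ {a b} (θ : CrossedTheta a b) → let open CrossedTheta θ in
      length xs ≡ₘ k′ [mod m ] × length ys ≡ₘ k′ [mod m ] × length zs ≡ₘ k′ [mod m ]
    crossedTheta-sides-≡ₘk′ θ =
      theta-≡ₘk′ {a = length ys} {b = length zs} (+-comm-≡ₘ {x = length xs} XY) (+-comm-≡ₘ {x = length xs} XZ) YZ ,
      theta-≡ₘk′ {a = length xs} {b = length zs} XY (+-comm-≡ₘ {x = length ys} YZ) XZ ,
      theta-≡ₘk′ {a = length xs} {b = length ys} XZ YZ XY
      where
      open CrossedTheta θ
      2≤X : 2 ≤ length xs
      2≤X = Cut⇒2≤length (cutAt X a∈ a≢z₂)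
      2≤Y : 2 ≤ length ys
      2≤Y = Cut⇒2≤length (cutAt Y b∈ b≢z₂)
      1≤Z : 1 ≤ length zs
      1≤Z = ≢⇒1≤length (proj₁ Z) z₁≢z₂
      XY : length xs + length ys ≡ₘ k [mod m ]
      XY = meetOnlyAt-≡ₘk G cycles z₁≢z₂ X Y mXY (2≤+1≤⇒3≤ 2≤X (≤-trans (s≤s z≤n) 2≤Y))
      XZ : length xs + length zs ≡ₘ k [mod m ]
      XZ = meetOnlyAt-≡ₘk G cycles z₁≢z₂ X Z mXZ (2≤+1≤⇒3≤ 2≤X 1≤Z)
      YZ : length ys + length zs ≡ₘ k [mod m ]
      YZ = meetOnlyAt-≡ₘk G cycles z₁≢z₂ Y Z mYZ (2≤+1≤⇒3≤ 2≤Y 1≤Z)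

    -- the two a–b paths through Z use complementary pieces of X and Y
    crossedTheta-absurd : ∀ {a b} → 0 < k → k < m → CrossedTheta a b →
      (∀ {ps} → SimplePath (Adj G) a ps b → length ps ≡ₘ k′ [mod m ]) → ⊥
    crossedTheta-absurd 0<k k<m θ ab≡k′ =
      crossing-≡ₘk′-absurd {a = length CX.front} {b = length CX.back} {c = length CY.front}
                           {d = length CY.back} {t = length zs} 0<k k<m
        (≡ₘ-trans (≡ₘ-reflexive (sym length-xs)) (proj₁ sides))
        (≡ₘ-trans (≡ₘ-reflexive (sym length-ys)) (proj₁ (proj₂ sides)))
        (proj₂ (proj₂ sides))
        (≡ₘ-trans (≡ₘ-reflexive length-viaZ) (ab≡k′ viaZ))
        (≡ₘ-trans (≡ₘ-reflexive length-viaZ⁻¹) (ab≡k′ viaZ⁻¹))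
      where
      open CrossedTheta θ
      open CrossingPaths θ
      sides : length xs ≡ₘ k′ [mod m ] × length ys ≡ₘ k′ [mod m ] × length zs ≡ₘ k′ [mod m ]
      sides = crossedTheta-sides-≡ₘk′ θ
      length-xs : length xs ≡ length CX.front + length CX.back
      length-xs = trans (cong length CX.split) (length-++ CX.front)
      length-ys : length ys ≡ length CY.front + length CY.back
      length-ys = trans (cong length CY.split) (length-++ CY.front)

module _ {n : ℕ} (G : Graph n) where
  open import Data.List.Membership.DecPropositional (_≟_ {n}) using (_∈?_)

  -- a segment z₂ → z₁ of R from the second arm gs of a fan to its first arm x ∷ fs,
  -- touching the arms only at its ends
  record Bridge (x v : Fin n) (fs gs rs : List (Fin n)) : Set where
    field
      {z₁ z₂}  : Fin n
      {ts}     : List (Fin n)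
      z₁∈      : z₁ ∈ x ∷ fs
      z₁≢v     : z₁ ≢ v
      z₂∈      : z₂ ∈ gs
      path     : SimplePath (Adj G) z₂ ts z₁
      onR      : z₂ ∷ ts ⊆ x ∷ rs
      leaves₁  : ∀ {w} → w ∈ z₂ ∷ ts → w ∈ x ∷ fs → w ≡ z₁
      leaves₂  : ∀ {w} → w ∈ z₂ ∷ ts → w ∈ gs → w ≡ z₂

  bridge : ∀ {x v y fs gs rs} → SimplePath (Adj G) x rs y → v ∉ x ∷ rs → y ∈ gs → Bridge x v fs gs rs
  bridge {x} {v} {fs = fs} {gs} R v∉R y∈gs
    with firstHit (_∈? gs) (proj₁ R) y∈gs
  ... | z₂ , ra , _ , refl , RA , _ , z₂∈ , first₂
    with reversePath (Adj-sym G) (RA , Unique-++⁻ˡ (x ∷ ra) (proj₂ R))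
  ... | reversal rra RRA RRA⊆ _
    with firstHit (λ w → (w ∈? (x ∷ fs)) ×-dec ¬? (w ≟ v)) (proj₁ RRA) (here refl , x≢v)
    where
    x≢v : x ≢ v
    x≢v refl = v∉R (here refl)
  ... | z₁ , ta , _ , refl , TA , _ , (z₁∈ , z₁≢v) , first₁ = record
    { z₁∈     = z₁∈
    ; z₁≢v    = z₁≢v
    ; z₂∈     = z₂∈
    ; path    = TA , Unique-++⁻ˡ (z₂ ∷ ta) (proj₂ RRA)
    ; onR     = λ w∈ → ∈-++⁺ˡ (onRA w∈)
    ; leaves₁ = λ w∈ w∈fs → first₁ w∈ (w∈fs , λ w≡v → v∉R (∈-++⁺ˡ (subst (_∈ x ∷ ra) w≡v (onRA w∈))))
    ; leaves₂ = λ w∈ w∈gs → first₂ (onRA w∈) w∈gs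
    }
    where
    onRA : z₂ ∷ ta ⊆ x ∷ ra
    onRA w∈ = RRA⊆ (∈-++⁺ˡ w∈)

  module EarTheta (D : EarDecomposition G) (i : Fin (EarDecomposition.t D)) where
    open EarDecomposition D hiding (V)

    Old : Fin n → Set
    Old = PrevV P₀ ear i

    open Induced G Old
    open Prefixes G D

    s′ e′ : Fin n
    s′ = s (ear i)
    e′ = e (ear i)

    I ws : List (Fin n)
    I  = inner (ear i)
    ws = I ++ [ e′ ]

    earSP : SimplePath (Adj G) s′ ws e′
    earSP = Linked⇒Walk ws (proj₁ (earPath i)) (last-∷ʳ s′ I e′) , proj₂ (earPath i)

    Old-s′ : Old s′
    Old-s′ = proj₁ (earEnds i)

    Old-e′ : Old e′
    Old-e′ = proj₂ (earEnds i)

    ¬Old-I : ∀ {w} → w ∈ I → ¬ Old w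
    ¬Old-I w∈ = earInner i _ w∈

    ws-Old⇒e′ : ∀ {w} → w ∈ ws → Old w → w ≡ e′
    ws-Old⇒e′ w∈ Old-w with ∈-++⁻ I w∈
    ... | inj₁ w∈I         = ⊥-elim (¬Old-I w∈I Old-w)
    ... | inj₂ (here refl) = refl

    -- The fan s′ → b → e′ in the old part, closed up by the ear, and a bridge between
    -- its arms along an s′–e′ path avoiding b, give a theta with a inside the ear side.
    earTheta : ∀ {a b} → a ∈ I → Old b → b ∉ earVerts (ear i) → CrossedTheta G a b
    earTheta {b = b} a∈I Old-b b∉ear
      with fan (prev-noCut i) (prev-third i) Old-s′ Old-b Old-e′ s′≢b e′≢b s′≢e′
         | prev-noCut i b s′ e′ Old-s′ Old-e′ s′≢b e′≢b
      where
      s′≢b : s′ ≢ b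
      s′≢b refl = b∉ear (here refl)
      e′≢b : e′ ≢ b
      e′≢b refl = b∉ear (there (∈-++⁺ʳ I (here refl)))
      s′≢e′ : s′ ≢ e′
      s′≢e′ s′≡e′ = Unique[x∷xs]⇒x∉xs (proj₂ earSP) (∈-++⁺ʳ I (here s′≡e′))
    ... | f₁ , f₂ , F₁ , F₂ , disjF | r₀ , R₀ , b∉R₀
      with bridge {fs = f₁} (PathIn⇒SimplePath R₀) b∉R₀ (≢⇒target∈ (proj₁ F₂) b≢e′)
      where
      b≢e′ : b ≢ e′
      b≢e′ refl = b∉ear (there (∈-++⁺ʳ I (here refl)))
    ... | B with splitPath (PathIn⇒SimplePath F₁) (Bridge.z₁∈ B)
               | splitPath (PathIn⇒SimplePath F₂) (there (Bridge.z₂∈ B))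
    ... | f₁a , f₁b , refl , F₁a , F₁b , d₁ | f₂a , f₂b , refl , F₂a , F₂b , d₂ = record
      { z₁≢z₂ = λ z₁≡z₂ → disjF (z₁∈ , subst (_∈ f₂a ++ f₂b) (sym z₁≡z₂) z₂∈)
      ; X     = joinPath Q₁.path (joinPath earSP Q₂.path disjEarQ₂) disjQ₁EarQ₂
      ; Y     = joinPath F₁b F₂a λ (w∈ , w∈f₂a) → disjF (arm₁b w∈ , ∈-++⁺ˡ w∈f₂a)
      ; Z     = RT.path
      ; mXY   = mXY
      ; mXZ   = mXZ
      ; mYZ   = mYZ
      ; a∈    = ∈-++⁺ʳ Q₁.tail (∈-++⁺ˡ (∈-++⁺ˡ a∈I))
      ; a≢z₂  = λ { refl → ¬Old-I a∈I (OldF₂ z₂∈) }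
      ; b∈    = ∈-++⁺ˡ (≢⇒target∈ (proj₁ F₁b) z₁≢v)
      ; b≢z₂  = λ { refl → Unique[x∷xs]⇒x∉xs (proj₂ F₂) z₂∈ }
      }
      where
      open Bridge B
      module Q₁ = Reversal (reversePath (Adj-sym G) F₁a)
      module Q₂ = Reversal (reversePath (Adj-sym G) F₂b)
      module RT = Reversal (reversePath (Adj-sym G) path)
      OldF₁ : ∀ {w} → w ∈ s′ ∷ f₁a ++ f₁b → Old w
      OldF₁ = PathIn⇒V Old-s′ F₁
      OldF₂ : ∀ {w} → w ∈ f₂a ++ f₂b → Old w
      OldF₂ w∈ = PathIn⇒V Old-b F₂ (there w∈)
      arm₁b : ∀ {w} → w ∈ z₁ ∷ f₁b → w ∈ s′ ∷ f₁a ++ f₁b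
      arm₁b (here refl) = z₁∈
      arm₁b (there w∈)  = there (∈-++⁺ʳ f₁a w∈)
      arm₂b : ∀ {w} → w ∈ z₂ ∷ f₂b → w ∈ f₂a ++ f₂b
      arm₂b (here refl) = z₂∈
      arm₂b (there w∈)  = ∈-++⁺ʳ f₂a w∈
      onQ₂ : ∀ {w} → w ∈ Q₂.tail → w ∈ f₂a ++ f₂b
      onQ₂ w∈ = arm₂b (Q₂.⊆forward (there w∈))
      disjEarQ₂ : Disjoint (s′ ∷ ws) Q₂.tail
      disjEarQ₂ (here refl , w∈Q₂) = disjF (here refl , onQ₂ w∈Q₂)
      disjEarQ₂ (there w∈ , w∈Q₂) with ws-Old⇒e′ w∈ (OldF₂ (onQ₂ w∈Q₂))
      ... | refl = Unique[x∷xs]⇒x∉xs (proj₂ Q₂.path) w∈Q₂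
      disjQ₁EarQ₂ : Disjoint (z₁ ∷ Q₁.tail) (ws ++ Q₂.tail)
      disjQ₁EarQ₂ (w∈Q₁ , w∈EQ) with ∈-++⁺ˡ (Q₁.⊆forward w∈Q₁) | ∈-++⁻ ws w∈EQ
      ... | w∈F₁ | inj₂ w∈Q₂ = disjF (w∈F₁ , onQ₂ w∈Q₂)
      ... | w∈F₁ | inj₁ w∈ws with ws-Old⇒e′ w∈ws (OldF₁ w∈F₁)
      ...   | refl = disjF (w∈F₁ , arm₂b (target∈ (proj₁ F₂b)))
      onX : ∀ {w} → w ∈ Q₁.tail ++ (ws ++ Q₂.tail) → w ∈ s′ ∷ f₁a ⊎ w ∈ I ⊎ w ∈ z₂ ∷ f₂b
      onX w∈ with ∈-++⁻ Q₁.tail w∈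
      ... | inj₁ w∈Q₁ = inj₁ (Q₁.⊆forward (there w∈Q₁))
      ... | inj₂ w∈EQ with ∈-++⁻ ws w∈EQ
      ...   | inj₂ w∈Q₂ = inj₂ (inj₂ (Q₂.⊆forward (there w∈Q₂)))
      ...   | inj₁ w∈ws with ∈-++⁻ I w∈ws
      ...     | inj₁ w∈I         = inj₂ (inj₁ w∈I)
      ...     | inj₂ (here refl) = inj₂ (inj₂ (target∈ (proj₁ F₂b)))
      mXY : MeetOnlyAt z₂ (Q₁.tail ++ (ws ++ Q₂.tail)) (f₁b ++ f₂a)
      mXY w∈X w∈Y with onX w∈X | ∈-++⁻ f₁b w∈Y
      ... | inj₁ w∈A          | inj₁ w∈f₁b = ⊥-elim (d₁ (w∈A , w∈f₁b))
      ... | inj₂ (inj₁ w∈I)   | inj₁ w∈f₁b = ⊥-elim (¬Old-I w∈I (OldF₁ (arm₁b (there w∈f₁b))))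
      ... | inj₂ (inj₂ w∈C)   | inj₁ w∈f₁b = ⊥-elim (disjF (arm₁b (there w∈f₁b) , arm₂b w∈C))
      ... | inj₁ w∈A          | inj₂ w∈f₂a = ⊥-elim (disjF (∈-++⁺ˡ w∈A , ∈-++⁺ˡ w∈f₂a))
      ... | inj₂ (inj₁ w∈I)   | inj₂ w∈f₂a = ⊥-elim (¬Old-I w∈I (OldF₂ (∈-++⁺ˡ w∈f₂a)))
      ... | inj₂ (inj₂ (here refl))    | inj₂ _     = refl
      ... | inj₂ (inj₂ (there w∈f₂b)) | inj₂ w∈f₂a = ⊥-elim (d₂ (there w∈f₂a , w∈f₂b))
      z₁∉RT : z₁ ∉ RT.tail
      z₁∉RT = Unique[x∷xs]⇒x∉xs (proj₂ RT.path)
      onT : ∀ {w} → w ∈ RT.tail → w ∈ z₂ ∷ _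
      onT w∈ = RT.⊆forward (there w∈)
      mXZ : MeetOnlyAt z₂ (Q₁.tail ++ (ws ++ Q₂.tail)) RT.tail
      mXZ w∈X w∈Z with onX w∈X
      ... | inj₁ w∈A with leaves₁ (onT w∈Z) (∈-++⁺ˡ w∈A)
      ...   | refl = ⊥-elim (z₁∉RT w∈Z)
      mXZ w∈X w∈Z | inj₂ (inj₁ w∈I) = ⊥-elim (¬Old-I w∈I (PathIn⇒V Old-s′ R₀ (onR (onT w∈Z))))
      mXZ w∈X w∈Z | inj₂ (inj₂ w∈C) = leaves₂ (onT w∈Z) (arm₂b w∈C)
      mYZ : MeetOnlyAt z₂ (f₁b ++ f₂a) RT.tail
      mYZ w∈Y w∈Z with ∈-++⁻ f₁b w∈Y
      ... | inj₂ w∈f₂a = leaves₂ (onT w∈Z) (∈-++⁺ˡ w∈f₂a)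
      ... | inj₁ w∈f₁b with leaves₁ (onT w∈Z) (arm₁b (there w∈f₁b))
      ...   | refl = ⊥-elim (z₁∉RT w∈Z)

minimal : ∀ {t} (P : Fin t → Set) → (∀ j → Dec (P j)) → (j : Fin t) → P j →
  ∃ λ i → P i × (∀ j → toℕ j < toℕ i → ¬ P j)
minimal {suc t} P P? j Pj with P? Fin.zero
... | yes P0 = Fin.zero , P0 , λ _ ()
minimal {suc t} P P? Fin.zero    P0 | no ¬P0 = ⊥-elim (¬P0 P0)
minimal {suc t} P P? (Fin.suc j) Pj | no ¬P0 with minimal (λ x → P (Fin.suc x)) (λ x → P? (Fin.suc x)) j Pj
... | i , Pi , below = Fin.suc i , Pi , λ { Fin.zero _ → ¬P0 ; (Fin.suc j′) (s≤s j′<i) → below j′ j′<i }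

module SameEar {n : ℕ} (G : Graph n) (D : EarDecomposition G)
  {k m k′ : ℕ} (cycles : AllCyclesMod G k m) (2∤m : ¬ 2 ∣ m) (2k′≡k : 2 * k′ ≡ₘ k [mod m ])
  (0<k : 0 < k) (k<m : k < m) where
  open EarDecomposition D hiding (V)
  open import Data.List.Membership.DecPropositional (_≟_ {n}) using (_∈?_)

  FirstOn : Fin n → Set
  FirstOn x = ∃ λ i → x ∈ DecV P₀ ear i × (∀ j → toℕ j < toℕ i → x ∉ DecV P₀ ear j)

  firstOn : ∀ x → FirstOn x
  firstOn x with coverV x
  ... | j , x∈ = minimal (λ j → x ∈ DecV P₀ ear j) (λ j → x ∈? DecV P₀ ear j) j x∈

  AllPaths≡k′ : Fin n → Fin n → Set
  AllPaths≡k′ a b = ∀ {xs} → SimplePath (Adj G) a xs b → length xs ≡ₘ k′ [mod m ]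

  -- if a appears no earlier than b, then a's ear contains b: otherwise a is a new
  -- vertex of that ear and b is older, which gives a crossed theta
  sameEar-≤ : ∀ {a b} → AllPaths≡k′ a b → (fa : FirstOn a) (fb : FirstOn b) → toℕ (proj₁ fb) ≤ toℕ (proj₁ fa) →
    ∃ λ j → a ∈ DecV P₀ ear j × b ∈ DecV P₀ ear j
  sameEar-≤ ab≡k′ (Fin.zero , a∈ , _) (Fin.zero , b∈ , _) _ = Fin.zero , a∈ , b∈
  sameEar-≤ {a} {b} ab≡k′ (Fin.suc i , a∈ , a-new) (jb , b∈ , _) jb≤1+i with b ∈? earVerts (ear i)
  ... | yes b∈ear = Fin.suc i , a∈ , b∈ear
  ... | no b∉ear  = ⊥-elim (crossedTheta-absurd G cycles 2∤m 2k′≡k 0<k k<m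
                      (EarTheta.earTheta G D i (inner∈ a∈) Old-b b∉ear) ab≡k′)
    where
    Old-b : PrevV P₀ ear i b
    Old-b with m≤n⇒m<n∨m≡n jb≤1+i
    ... | inj₁ (s≤s jb≤i) = jb , jb≤i , b∈
    ... | inj₂ jb≡1+i with toℕ-injective {i = jb} {j = Fin.suc i} jb≡1+i
    ...   | refl = ⊥-elim (b∉ear b∈)
    ¬Old-a : ¬ PrevV P₀ ear i a
    ¬Old-a (j , j≤i , a∈j) = a-new j (s≤s j≤i) a∈j
    inner∈ : a ∈ earVerts (ear i) → a ∈ inner (ear i)
    inner∈ (here refl) = ⊥-elim (¬Old-a (proj₁ (earEnds i)))
    inner∈ (there a∈′) with ∈-++⁻ (inner (ear i)) a∈′
    ... | inj₁ a∈I         = a∈I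
    ... | inj₂ (here refl) = ⊥-elim (¬Old-a (proj₂ (earEnds i)))

  AllPaths≡k′-sym : ∀ {a b} → AllPaths≡k′ a b → AllPaths≡k′ b a
  AllPaths≡k′-sym ab≡k′ P with reversePath (Adj-sym G) P
  ... | reversal _ P⁻¹ _ length≡ = ≡ₘ-trans (≡ₘ-reflexive (sym length≡)) (ab≡k′ P⁻¹)

  sameEar : ∀ {a b} → AllPaths≡k′ a b → ∃ λ j → a ∈ DecV P₀ ear j × b ∈ DecV P₀ ear j
  sameEar {a} {b} ab≡k′ with ≤-total (toℕ (proj₁ (firstOn b))) (toℕ (proj₁ (firstOn a)))
  ... | inj₁ b≤a = sameEar-≤ ab≡k′ (firstOn a) (firstOn b) b≤a
  ... | inj₂ a≤b with sameEar-≤ (AllPaths≡k′-sym ab≡k′) (firstOn b) (firstOn a) a≤b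
  ...   | j , b∈ , a∈ = j , a∈ , b∈

module _ {n : ℕ} (G : Graph n) where
  open Induced G (λ _ → ⊤)

  TwoConnected⇒NoCutVertex : TwoConnected G → NoCutVertex
  TwoConnected⇒NoCutVertex (_ , _ , avoid) x a b _ _ a≢x b≢x with avoid x a b a≢x b≢x
  ... | p , x∉p with Path⇒SimplePath G p
  ... | xs , (w , U) , _ , verts≡ = xs , (Walk-restrict G w (λ _ → tt) , U) , subst (λ vs → x ∉ vs) verts≡ x∉p

  TwoConnected⇒ThirdVertex : TwoConnected G → ThirdVertex
  TwoConnected⇒ThirdVertex (s≤s (s≤s (s≤s _)) , _) a b
    with avoidTwo {c₀ = Fin.zero} {Fin.suc Fin.zero} {Fin.suc (Fin.suc Fin.zero)} a b _≟_ (λ ()) (λ ()) (λ ())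
  ... | w , _ , w≢a , w≢b = w , tt , w≢a , w≢b

theorem2p2 : (k m k′ : ℕ) → 0 < k → k < m → ¬ (2 ∣ m) → 2 * k′ ≡ₘ k [mod m ] →
  {n : ℕ} (G : Graph n) → TwoConnected G → AllCyclesMod G k m →
  (u v : Fin n) (u≢v : u ≢ v) (r : ℕ) → (r ≡ 0 → adj G u v ≡ false) →
  AllCyclesMod (attachEar G u v u≢v r) k m →
  ((p : Path (attachEar G u v u≢v r) (u ↑ˡ r) (v ↑ˡ r)) → pathLength p ≡ₘ k′ [mod m ])
  × ((D : EarDecomposition G) →
       ∃ λ j → u ∈ EarDecomposition.V D j × v ∈ EarDecomposition.V D j)
theorem2p2 k m k′ 0<k k<m 2∤m 2k′≡k G twoConnected cyclesG u v u≢v r noEdge cyclesH =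
  uvPathInH≡k′ , λ D → SameEar.sameEar G D cyclesG 2∤m 2k′≡k 0<k k<m uvPathInG≡k′
  where
  open Attached G u v u≢v r
  open EarLength G u v u≢v r {k′ = k′} 2∤m 2k′≡k
  open Induced G (λ _ → ⊤)
  θ : Theta u v
  θ = whitney (TwoConnected⇒NoCutVertex G twoConnected) (TwoConnected⇒ThirdVertex G twoConnected) tt tt u≢v
  ear≡k′ : r + 1 ≡ₘ k′ [mod m ]
  ear≡k′ with θ
  ... | _ , _ , A , B , meet , 3≤ =
    ear-≡ₘk′ cyclesH noEdge cyclesG (PathIn⇒SimplePath A) (PathIn⇒SimplePath B) meet 3≤
  uvPathInH≡k′ : (p : Path H (old u) (old v)) → pathLength p ≡ₘ k′ [mod m ]
  uvPathInH≡k′ = uvPath-≡ₘk′ cyclesH ear≡k′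
  uvPathInG≡k′ : ∀ {xs} → SimplePath (Adj G) u xs v → length xs ≡ₘ k′ [mod m ]
  uvPathInG≡k′ {xs} P with SimplePath⇒Path H (liftPath P)
  ... | p , length≡ = subst (_≡ₘ k′ [mod m ]) (trans length≡ (length-map old xs)) (uvPathInH≡k′ p)
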